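{- Let $\mathbf{d}=(d_1,\dots,d_n)$ be a graphical sequence. Then $\mathbf{d}$ admits a realization which is a $C_4$-pivotable graph if and only if $\sum_{i=1}^n d_i=4(n-1)-4$, $d_1<n-1$, and $d_n\ge 2$.
   Context: A degree sequence is non-increasing, $d_1\ge\dots\ge d_n\ge 0$; it is graphical if some simple graph on $v_1,\dots,v_n$ has $\deg(v_i)=d_i$ (a realization). A simple graph $G$ on $n$ vertices with exactly $2n-4$ edges is $C_4$-pivotable if $G$ contains an induced cycle $C$ of length 4 (the central cycle) and two spanning trees whose edge sets have exactly two common edges, both of which are edges of $C$. -}

module Defs where

open import Data.Nat using (ℕ; zero; suc; _+_; _*_; _≤_; _<_)
open import Data.Bool using (Bool; true; false; if_then_else_; _∧_)
open import Data.Fin using (Fin; toℕ; inject₁; fromℕ) renaming (zero to fzero; suc to fsuc)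
open import Data.Fin.Properties using (_<?_)
open import Data.List using (List; map; allFin)
open import Data.Nat.ListAction using (sum)
open import Data.Product using (Σ; ∃; ∃-syntax; _×_; _,_)
open import Data.Sum using (_⊎_)
open import Function.Definitions using (Injective)
open import Relation.Nullary using (¬_; does)
open import Relation.Binary.PropositionalEquality using (_≡_)

record Graph (n : ℕ) : Set where
  field
    adj    : Fin n → Fin n → Bool
    sym    : ∀ i j → adj i j ≡ adj j i
    irrefl : ∀ i → adj i i ≡ false
open Graph public

Edge : ∀ {n} → Graph n → Fin n → Fin n → Set
Edge G u v = adj G u v ≡ true

ΣFin : ∀ n → (Fin n → ℕ) → ℕ
ΣFin n f = sum (map f (allFin n))

b2n : Bool → ℕ
b2n true  = 1
b2n false = 0

degree : ∀ {n} → Graph n → Fin n → ℕ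
degree {n} G i = ΣFin n (λ j → b2n (adj G i j))

edgeCount : ∀ {n} → Graph n → ℕ
edgeCount {n} G = ΣFin n (λ i → ΣFin n (λ j → b2n (does (i <? j) ∧ adj G i j)))

-- degree sequences (indexed d_1 ... d_n by Fin n)
NonIncreasing : ∀ {n} → (Fin n → ℕ) → Set
NonIncreasing {n} d = ∀ (i j : Fin n) → toℕ i ≤ toℕ j → d j ≤ d i

IsRealization : ∀ {n} → Graph n → (Fin n → ℕ) → Set
IsRealization G d = ∀ i → degree G i ≡ d i

Graphical : ∀ {n} → (Fin n → ℕ) → Set
Graphical {n} d = NonIncreasing d × ∃[ G ] IsRealization {n} G d

data Walk {n} (G : Graph n) : Fin n → Fin n → Set where
  here : ∀ {u} → Walk G u u
  step : ∀ {u v w} → Edge G u v → Walk G v w → Walk G u w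

Connected : ∀ {n} → Graph n → Set
Connected {n} G = ∀ (u v : Fin n) → Walk G u v

-- a cycle of length k+3: distinct vertices c_0,...,c_{k+2} with c_i ~ c_{i+1} and c_{k+2} ~ c_0
record Cycle {n} (G : Graph n) (k : ℕ) : Set where
  field
    vtx   : Fin (suc (suc (suc k))) → Fin n
    inj   : Injective _≡_ _≡_ vtx
    cons  : ∀ (i : Fin (suc (suc k))) → Edge G (vtx (inject₁ i)) (vtx (fsuc i))
    close : Edge G (vtx (fromℕ (suc (suc k)))) (vtx fzero)

Acyclic : ∀ {n} → Graph n → Set
Acyclic G = ∀ k → ¬ Cycle G k

IsTree : ∀ {n} → Graph n → Set
IsTree G = Connected G × Acyclic G

IsSpanningTree : ∀ {n} → Graph n → Graph n → Set
IsSpanningTree {n} G T = (∀ (u v : Fin n) → Edge T u v → Edge G u v) × IsTree T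

InducedC4 : ∀ {n} → Graph n → Fin n → Fin n → Fin n → Fin n → Set
InducedC4 G a b c d =
  ¬ a ≡ b × ¬ a ≡ c × ¬ a ≡ d × ¬ b ≡ c × ¬ b ≡ d × ¬ c ≡ d ×
  Edge G a b × Edge G b c × Edge G c d × Edge G d a ×
  adj G a c ≡ false × adj G b d ≡ false

c4Edge : ∀ {n} → Fin n → Fin n → Fin n → Fin n → Fin 4 → Fin n × Fin n
c4Edge a b c d fzero                         = a , b
c4Edge a b c d (fsuc fzero)                  = b , c
c4Edge a b c d (fsuc (fsuc fzero))           = c , d
c4Edge a b c d (fsuc (fsuc (fsuc fzero)))    = d , a

SameEdge : ∀ {n} → Fin n → Fin n → Fin n × Fin n → Set
SameEdge u v (p , q) = (u ≡ p × v ≡ q) ⊎ (u ≡ q × v ≡ p)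

CommonEdge : ∀ {n} → Graph n → Graph n → Fin n → Fin n → Set
CommonEdge T₁ T₂ u v = Edge T₁ u v × Edge T₂ u v

ExactlyTwoCommonCycleEdges : ∀ {n} → Graph n → Graph n → Fin n → Fin n → Fin n → Fin n → Set
ExactlyTwoCommonCycleEdges {n} T₁ T₂ a b c d =
  Σ (Fin 4) λ i → Σ (Fin 4) λ j →
    ¬ i ≡ j ×
    (∀ {p q} → c4Edge a b c d i ≡ (p , q) → CommonEdge T₁ T₂ p q) ×
    (∀ {p q} → c4Edge a b c d j ≡ (p , q) → CommonEdge T₁ T₂ p q) ×
    (∀ (u v : Fin n) → CommonEdge T₁ T₂ u v →
        SameEdge u v (c4Edge a b c d i) ⊎ SameEdge u v (c4Edge a b c d j))

-- G has exactly 2n-4 edges (written |E| + 4 = 2n to avoid truncated subtraction),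
-- an induced central 4-cycle, and two spanning trees with exactly two common edges,
-- both on the central cycle.
C4Pivotable : ∀ {n} → Graph n → Set
C4Pivotable {n} G =
  edgeCount G + 4 ≡ 2 * n ×
  Σ (Fin n) λ a → Σ (Fin n) λ b → Σ (Fin n) λ c → Σ (Fin n) λ d →
    InducedC4 G a b c d ×
    Σ (Graph n) λ T₁ → Σ (Graph n) λ T₂ →
      IsSpanningTree G T₁ × IsSpanningTree G T₂ ×
      ExactlyTwoCommonCycleEdges T₁ T₂ a b c d

{-# OPTIONS --safe #-}
-- A connected graph on n vertices has at least n - 1 edges, and the two spanning trees
-- share only two edges, so together they already account for all 2n - 4 edges of G. Hence, walking
-- from a vertex u towards an endpoint of a common edge, the first steps in the two trees differ unless
-- u lies on a common edge of the central cycle, which gives degree at least 2. A vertex adjacent to all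
-- others would close a cycle of length 3, 4 or 5 inside one tree together with the two common cycle
-- edges, so every degree is below n - 1. The degree sum is twice the number of edges.
--
-- Sufficiency, by induction from the 4-cycle. As the degrees sum to 4n - 8, some vertex has degree 2
-- or 3. A degree-2 vertex is removed and re-attached as a leaf of the two vertices of largest remaining
-- degree, one in each tree. Otherwise a degree-3 vertex is re-attached by subdividing an edge that lies
-- in only one tree and does not join two cycle vertices, and as a leaf of a third vertex in the other
-- tree. The bounds 2 ≤ d_i ≤ n - 2 are what keep the reduced sequence admissible.

module Submission where

open import Defs hiding (sym)
open import Data.Bool using (Bool; true; false; _∧_; _∨_; not)
open import Data.Bool.Properties using (∨-comm; ∨-zeroʳ; ∨-identityʳ; ∧-comm; ∧-conicalˡ; ∧-identityʳ)
import Data.Bool as Bool using (_≟_)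
open import Data.Fin using (Fin; toℕ; inject₁; fromℕ) renaming (zero to fzero; suc to fsuc)
open import Data.Fin.Patterns using (0F; 1F; 2F; 3F)
open import Data.Fin.Permutation using (Permutation′; _⟨$⟩ʳ_; _⟨$⟩ˡ_; inverseˡ; inverseʳ; flip; transpose)
open import Data.Fin.Properties using (_≟_; _<?_; <-cmp; any?; all?; toℕ-inject₁; toℕ-fromℕ; toℕ≤pred[n]; suc-injective)
import Data.List as List using (map; tabulate)
import Data.List.Properties as List
import Data.Nat.ListAction as List
open import Data.Nat using (ℕ; zero; suc; _+_; _*_; _∸_; _≤_; _<_; z≤n; s≤s)
open import Data.Nat.Properties hiding (_≟_; _<?_; <-cmp; suc-injective)
import Data.Nat.Properties as ℕ using (_≟_; _<?_; <-cmp)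
open import Data.Nat.Induction using (<-wellFounded)
open import Data.Nat.Tactic.RingSolver using (solve-∀)
open import Induction.WellFounded using (Acc; acc)
open import Data.Product using (Σ; ∃; _×_; _,_; proj₁; proj₂) renaming (swap to ×-swap)
open import Data.Sum using (_⊎_; inj₁; inj₂) renaming (swap to ⊎-swap)
import Data.Sum as Sum using (map)
open import Data.Vec using (Vec; []; _∷_; lookup)
open import Data.Vec.Functional using (Vector; updateAt)
open import Data.Vec.Functional.Properties using (updateAt-updates; updateAt-minimal)
open import Data.Vec.Relation.Unary.All using ([]; _∷_)
open import Data.Vec.Relation.Unary.AllPairs using ([]; _∷_)
open import Data.Vec.Relation.Unary.Linked using (Linked; []; [-]; _∷_)
open import Data.Vec.Relation.Unary.Unique.Propositional using (Unique)
open import Data.Vec.Relation.Unary.Unique.Propositional.Properties using (lookup-injective)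
open import Function using (_∘_; const)
open import Function.Bundles using (Injection; _⇔_; mk⇔)
open import Function.Properties.Inverse using (↔⇒↣)
open import Relation.Binary using (tri<; tri≈; tri>)
open import Relation.Binary.PropositionalEquality
open import Relation.Nullary using (¬_; Dec; yes; no; does; contradiction)
open import Data.Empty using (⊥; ⊥-elim)
open import Relation.Nullary.Decidable using (True; toWitness; from-yes; ¬?; dec-true; dec-false; _⊎-dec_; _×-dec_; _→-dec_)
open import Algebra.Properties.CommutativeMonoid.Sum +-0-commutativeMonoid
  using (sum; sum-cong-≗; ∑-distrib-+; ∑-comm; sum-permute)

-- Finite sums

sum-const : ∀ n c → sum {n} (const c) ≡ n * c
sum-const zero    c = refl
sum-const (suc n) c = cong (c +_) (sum-const n c)

sum-zero : ∀ n → sum {n} (const 0) ≡ 0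
sum-zero n = trans (sum-const n 0) (*-zeroʳ n)

sum-mono-≤ : ∀ {n} {f g : Vector ℕ n} → (∀ i → f i ≤ g i) → sum f ≤ sum g
sum-mono-≤ {zero}  f≤g = z≤n
sum-mono-≤ {suc n} f≤g = +-mono-≤ (f≤g fzero) (sum-mono-≤ (f≤g ∘ fsuc))

sum-mono-< : ∀ {n} {f g : Vector ℕ n} → (∀ i → f i ≤ g i) → ∀ x → f x < g x → sum f < sum g
sum-mono-< f≤g fzero    fx<gx = +-mono-<-≤ fx<gx (sum-mono-≤ (f≤g ∘ fsuc))
sum-mono-< f≤g (fsuc x) fx<gx = +-mono-≤-< (f≤g fzero) (sum-mono-< (f≤g ∘ fsuc) x fx<gx)

sum-updateAt : ∀ {n} (g : Vector ℕ n) i (h : ℕ → ℕ) → sum (updateAt g i h) + g i ≡ sum g + h (g i)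
sum-updateAt g fzero    h = rotate (h (g fzero)) (sum (g ∘ fsuc)) (g fzero)
  where
  rotate : ∀ a b c → a + b + c ≡ c + b + a
  rotate = solve-∀
sum-updateAt g (fsuc i) h = begin
  g fzero + sum (updateAt (g ∘ fsuc) i h) + g (fsuc i)   ≡⟨ +-assoc (g fzero) _ _ ⟩
  g fzero + (sum (updateAt (g ∘ fsuc) i h) + g (fsuc i)) ≡⟨ cong (g fzero +_) (sum-updateAt (g ∘ fsuc) i h) ⟩
  g fzero + (sum (g ∘ fsuc) + h (g (fsuc i)))            ≡⟨ +-assoc (g fzero) _ _ ⟨
  sum g + h (g (fsuc i))                                 ∎
  where open ≡-Reasoning

sum-split : ∀ {n} (f : Vector ℕ n) x → f x + sum (updateAt f x (const 0)) ≡ sum f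
sum-split f x = trans (+-comm (f x) _) (trans (sum-updateAt f x (const 0)) (+-identityʳ (sum f)))

sum-point-≤ : ∀ {n} (f : Vector ℕ n) x → f x ≤ sum f
sum-point-≤ f x = subst (f x ≤_) (sum-split f x) (m≤m+n (f x) _)

sum-pair-≤ : ∀ {n} (f : Vector ℕ n) {x y} → ¬ x ≡ y → f x + f y ≤ sum f
sum-pair-≤ f {x} {y} x≢y = begin
  f x + f y                          ≡⟨ cong (f x +_) (updateAt-minimal y x f (x≢y ∘ sym)) ⟨
  f x + updateAt f x (const 0) y     ≤⟨ +-monoʳ-≤ (f x) (sum-point-≤ (updateAt f x (const 0)) y) ⟩
  f x + sum (updateAt f x (const 0)) ≡⟨ sum-split f x ⟩
  sum f                              ∎
  where open ≤-Reasoning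

sum-triple-≤ : ∀ {n} (f : Vector ℕ n) {x y z} → ¬ x ≡ y → ¬ x ≡ z → ¬ y ≡ z → f x + f y + f z ≤ sum f
sum-triple-≤ {n} f {x} {y} {z} x≢y x≢z y≢z = begin
  f x + f y + f z                    ≡⟨ +-assoc (f x) _ _ ⟩
  f x + (f y + f z)                  ≡⟨ cong (f x +_) (cong₂ _+_ (unchanged y x≢y) (unchanged z x≢z)) ⟨
  f x + (f′ y + f′ z)                ≤⟨ +-monoʳ-≤ (f x) (sum-pair-≤ f′ y≢z) ⟩
  f x + sum f′                       ≡⟨ sum-split f x ⟩
  sum f                              ∎
  where
  open ≤-Reasoning
  f′ : Vector ℕ n
  f′ = updateAt f x (const 0)
  unchanged : ∀ w → ¬ x ≡ w → f′ w ≡ f w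
  unchanged w x≢w = updateAt-minimal w x f (x≢w ∘ sym)

sum² : ∀ {n} → (Fin n → Fin n → ℕ) → ℕ
sum² f = sum (λ u → sum (f u))

sum²-distrib-+ : ∀ {n} (f g : Fin n → Fin n → ℕ) → sum² (λ u v → f u v + g u v) ≡ sum² f + sum² g
sum²-distrib-+ f g = trans (sum-cong-≗ (λ u → ∑-distrib-+ (f u) (g u))) (∑-distrib-+ (λ u → sum (f u)) (λ u → sum (g u)))

sum-∸ : ∀ {n} (f g : Vector ℕ n) → (∀ i → g i ≤ f i) → sum (λ i → f i ∸ g i) + sum g ≡ sum f
sum-∸ f g g≤f = trans (sym (∑-distrib-+ (λ i → f i ∸ g i) g)) (sum-cong-≗ (λ i → m∸n+n≡m (g≤f i)))

sum-≥-const : ∀ {n} {f : Vector ℕ n} c → (∀ i → c ≤ f i) → n * c ≤ sum f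
sum-≥-const {n} c c≤f = subst (_≤ _) (sum-const n c) (sum-mono-≤ c≤f)

sum-≤-const : ∀ {n} {f : Vector ℕ n} c → (∀ i → f i ≤ c) → sum f ≤ n * c
sum-≤-const {n} c f≤c = subst (_ ≤_) (sum-const n c) (sum-mono-≤ f≤c)

sum-≥-point : ∀ {n} (f : Vector ℕ n) c → (∀ i → c ≤ f i) → ∀ x → n * c + f x ≤ sum f + c
sum-≥-point {n} f c c≤f x = begin
  n * c + f x                          ≤⟨ +-monoˡ-≤ (f x) (sum-≥-const c lowered) ⟩
  sum (updateAt f x (const c)) + f x   ≡⟨ sum-updateAt f x (const c) ⟩
  sum f + c                            ∎
  where
  open ≤-Reasoning
  lowered : ∀ i → c ≤ updateAt f x (const c) i
  lowered i with i ≟ x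
  ... | yes refl = ≤-reflexive (sym (updateAt-updates i f))
  ... | no i≢x   = subst (c ≤_) (sym (updateAt-minimal i x f i≢x)) (c≤f i)

sum-≤-const⇒≡ : ∀ {n} {f : Vector ℕ n} c → (∀ i → c ≤ f i) → sum f ≤ n * c → ∀ i → f i ≡ c
sum-≤-const⇒≡ {n} {f} c c≤f sum≤ i with c ℕ.<? f i
... | no  c≮fi = ≤-antisym (≮⇒≥ c≮fi) (c≤f i)
... | yes c<fi = ⊥-elim (<-irrefl refl (≤-trans (subst (_< sum f) (sum-const n c) (sum-mono-< c≤f i c<fi)) sum≤))

sum-≤-point : ∀ {n} (f : Vector ℕ n) c x → (∀ i → ¬ i ≡ x → f i ≤ c) → sum f + c ≤ n * c + f x
sum-≤-point {n} f c x f≤c = begin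
  sum f + c                            ≡⟨ sum-updateAt f x (const c) ⟨
  sum (updateAt f x (const c)) + f x   ≤⟨ +-monoˡ-≤ (f x) (sum-≤-const c raised) ⟩
  n * c + f x                          ∎
  where
  open ≤-Reasoning
  raised : ∀ i → updateAt f x (const c) i ≤ c
  raised i with i ≟ x
  ... | yes refl = ≤-reflexive (updateAt-updates i f)
  ... | no i≢x   = subst (_≤ c) (sym (updateAt-minimal i x f i≢x)) (f≤c i i≢x)

sum-≥-triple : ∀ {n} (f : Vector ℕ n) c → (∀ i → c ≤ f i) → ∀ {x y z} → ¬ x ≡ y → ¬ x ≡ z → ¬ y ≡ z →
               n * c + (f x + f y + f z) ≤ sum f + 3 * c
sum-≥-triple {n} f c c≤f {x} {y} {z} x≢y x≢z y≢z = begin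
  n * c + (f x + f y + f z)               ≡⟨ cong (n * c +_) (cong₂ _+_ (cong₂ _+_ (excess x) (excess y)) (excess z)) ⟨
  n * c + (h x + c + (h y + c) + (h z + c)) ≡⟨ regroup (n * c) (h x) (h y) (h z) c ⟩
  n * c + (h x + h y + h z) + 3 * c       ≤⟨ +-monoˡ-≤ (3 * c) (+-monoʳ-≤ (n * c) (sum-triple-≤ h x≢y x≢z y≢z)) ⟩
  n * c + sum h + 3 * c                   ≡⟨ cong (_+ 3 * c) (trans (+-comm (n * c) (sum h)) shifted) ⟩
  sum f + 3 * c                           ∎
  where
  open ≤-Reasoning
  h : Vector ℕ n
  h i = f i ∸ c
  shifted : sum h + n * c ≡ sum f
  shifted = trans (cong (sum h +_) (sym (sum-const n c))) (sum-∸ f (const c) c≤f)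
  excess : ∀ i → h i + c ≡ f i
  excess i = m∸n+n≡m (c≤f i)
  regroup : ∀ a b₁ b₂ b₃ c → a + (b₁ + c + (b₂ + c) + (b₃ + c)) ≡ a + (b₁ + b₂ + b₃) + 3 * c
  regroup = solve-∀

-- Degrees

indicator : ∀ {n} → Fin n → Fin n → ℕ
indicator x j = b2n (does (j ≟ x))

sum-indicator : ∀ {n} (x : Fin n) → sum (indicator x) ≡ 1
sum-indicator {suc n} fzero    = cong suc (sum-zero n)
sum-indicator {suc n} (fsuc x) = sum-indicator x

b2n≤1 : ∀ b → b2n b ≤ 1
b2n≤1 true  = s≤s z≤n
b2n≤1 false = z≤n

true≢false : ¬ true ≡ false
true≢false ()

≟-true⇒≡ : ∀ {n} (i j : Fin n) → does (i ≟ j) ≡ true → i ≡ j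
≟-true⇒≡ i j eq with i ≟ j
... | yes i≡j = i≡j
≟-true⇒≡ i j () | no _

ΣFin≡sum : ∀ n (f : Vector ℕ n) → ΣFin n f ≡ sum f
ΣFin≡sum zero    f = refl
ΣFin≡sum (suc n) f = cong (f fzero +_) (begin
  List.sum (List.map f (List.tabulate fsuc))               ≡⟨ cong List.sum (List.map-tabulate fsuc f) ⟩
  List.sum (List.tabulate (f ∘ fsuc))                      ≡⟨ cong List.sum (List.map-tabulate (λ i → i) (f ∘ fsuc)) ⟨
  ΣFin n (f ∘ fsuc)                                        ≡⟨ ΣFin≡sum n (f ∘ fsuc) ⟩
  sum (f ∘ fsuc)                                           ∎)
  where open ≡-Reasoning

Edge-sym : ∀ {n} (G : Graph n) {u v} → Edge G u v → Edge G v u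
Edge-sym G {u} {v} e = trans (Graph.sym G v u) e

deg : ∀ {n} → Graph n → Fin n → ℕ
deg G i = sum (λ j → b2n (adj G i j))

degree≡deg : ∀ {n} (G : Graph n) i → degree G i ≡ deg G i
degree≡deg {n} G i = ΣFin≡sum n _

ordered : ∀ {n} → Graph n → Fin n → Fin n → ℕ
ordered G i j = b2n (does (i <? j) ∧ adj G i j)

edgeCount≡sum : ∀ {n} (G : Graph n) → edgeCount G ≡ sum² (ordered G)
edgeCount≡sum {n} G = trans (ΣFin≡sum n (λ i → ΣFin n (ordered G i))) (sum-cong-≗ (λ i → ΣFin≡sum n (ordered G i)))

adj≡ordered+ordered : ∀ {n} (G : Graph n) i j → b2n (adj G i j) ≡ ordered G i j + ordered G j i
adj≡ordered+ordered G i j with <-cmp i j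
... | tri< i<j _ j≮i rewrite dec-true (i <? j) i<j | dec-false (j <? i) j≮i = sym (+-identityʳ _)
... | tri> i≮j _ j<i rewrite dec-false (i <? j) i≮j | dec-true (j <? i) j<i = cong b2n (Graph.sym G i j)
... | tri≈ i≮j refl _ rewrite dec-false (i <? i) i≮j | Graph.irrefl G i = refl

handshake : ∀ {n} (G : Graph n) → edgeCount G + edgeCount G ≡ sum (deg G)
handshake G = begin
  edgeCount G + edgeCount G                 ≡⟨ cong₂ _+_ (edgeCount≡sum G) (edgeCount≡sum G) ⟩
  sum² (ordered G) + sum² (ordered G)       ≡⟨ cong (sum² (ordered G) +_) (∑-comm (ordered G)) ⟩
  sum² (ordered G) + sum² (λ i j → ordered G j i) ≡⟨ sum²-distrib-+ (ordered G) (λ i j → ordered G j i) ⟨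
  sum² (λ i j → ordered G i j + ordered G j i)    ≡⟨ sum-cong-≗ (λ i → sum-cong-≗ (adj≡ordered+ordered G i)) ⟨
  sum (deg G)                               ∎
  where open ≡-Reasoning

closedNbhd : ∀ {n} → Graph n → Fin n → Fin n → ℕ
closedNbhd G v j = b2n (adj G v j) + indicator v j

closedNbhd≤1 : ∀ {n} (G : Graph n) v j → closedNbhd G v j ≤ 1
closedNbhd≤1 G v j with j ≟ v
... | yes refl rewrite Graph.irrefl G j = ≤-refl
... | no _     = ≤-trans (≤-reflexive (+-identityʳ _)) (b2n≤1 _)

sum-closedNbhd : ∀ {n} (G : Graph n) v → sum (closedNbhd G v) ≡ deg G v + 1
sum-closedNbhd G v = trans (∑-distrib-+ (λ j → b2n (adj G v j)) (indicator v)) (cong (deg G v +_) (sum-indicator v))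

deg≤ : ∀ {m} (G : Graph (suc m)) v → deg G v ≤ m
deg≤ {m} G v = +-cancelʳ-≤ 1 (deg G v) m (begin
  deg G v + 1              ≡⟨ sum-closedNbhd G v ⟨
  sum (closedNbhd G v)     ≤⟨ sum-≤-const 1 (closedNbhd≤1 G v) ⟩
  suc m * 1                ≡⟨ trans (*-identityʳ (suc m)) (+-comm 1 m) ⟩
  m + 1                    ∎)
  where open ≤-Reasoning

deg≡max⇒adjacent : ∀ {m} (G : Graph (suc m)) v → deg G v ≡ m → ∀ w → ¬ w ≡ v → Edge G v w
deg≡max⇒adjacent {m} G v deg≡m w w≢v with adj G v w in vw
... | true  = refl
... | false = ⊥-elim (m+1+n≰m (m + 1) (begin
  m + 1 + 1                       ≡⟨ cong (λ k → k + 1 + 1) deg≡m ⟨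
  deg G v + 1 + 1                 ≡⟨ cong (_+ 1) (sum-closedNbhd G v) ⟨
  sum (closedNbhd G v) + 1        ≤⟨ sum-≤-point (closedNbhd G v) 1 w (λ i _ → closedNbhd≤1 G v i) ⟩
  suc m * 1 + closedNbhd G v w    ≡⟨ cong₂ _+_ (*-identityʳ (suc m)) nonNeighbour ⟩
  suc m + 0                       ≡⟨ +-comm (suc m) 0 ⟩
  1 + m                           ≡⟨ +-comm 1 m ⟩
  m + 1                           ∎))
  where
  open ≤-Reasoning
  nonNeighbour : closedNbhd G v w ≡ 0
  nonNeighbour rewrite vw | dec-false (w ≟ v) w≢v = refl

two-neighbours⇒deg≥2 : ∀ {n} (G : Graph n) {u x y} → ¬ x ≡ y → Edge G u x → Edge G u y → 2 ≤ deg G u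
two-neighbours⇒deg≥2 G {u} {x} {y} x≢y ux uy =
  subst (_≤ deg G u) (cong₂ (λ p q → b2n p + b2n q) ux uy) (sum-pair-≤ (λ j → b2n (adj G u j)) x≢y)

-- Walks, rankings and trees

_++ʷ_ : ∀ {n} {G : Graph n} {u v w} → Walk G u v → Walk G v w → Walk G u w
here       ++ʷ q = q
step e p   ++ʷ q = step e (p ++ʷ q)

reverseʷ : ∀ {n} {G : Graph n} {u v} → Walk G u v → Walk G v u
reverseʷ         here       = here
reverseʷ {G = G} (step e p) = reverseʷ p ++ʷ step (Edge-sym G e) here

firstStep : ∀ {n} {G : Graph n} {u v} → ¬ u ≡ v → Walk G u v → Σ (Fin n) (Edge G u)
firstStep u≢v here               = ⊥-elim (u≢v refl)
firstStep u≢v (step {v = x} e _) = x , e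

least-witness : {P : ℕ → Set} → (∀ k → Dec (P k)) → ∀ k → P k → Σ ℕ λ m → P m × (∀ j → j < m → ¬ P j)
least-witness P? k Pk with P? 0
... | yes P0 = 0 , P0 , λ _ ()
least-witness P? zero    P0  | no ¬P0 = ⊥-elim (¬P0 P0)
least-witness P? (suc k) Pk  | no ¬P0 with least-witness (P? ∘ suc) k Pk
... | m , Pm , below = suc m , Pm , λ { zero _ → ¬P0 ; (suc j) (s≤s j<m) → below j j<m }

record RootedRanking {n} (T : Graph n) : Set where
  field
    rank    : Fin n → ℕ
    root    : Fin n
    parent  : Fin n → Fin n
    descend : ∀ v → v ≡ root ⊎ (Edge T v (parent v) × rank (parent v) < rank v)

module _ {n} {T : Graph n} (R : RootedRanking T) where
  open RootedRanking R

  private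
    isChild : Fin n → Fin n → Bool
    isChild i j = not (does (i ≟ root)) ∧ does (j ≟ parent i)

    isChild⇒ : ∀ i j → isChild i j ≡ true → Edge T i j × rank j < rank i
    isChild⇒ i j child with i ≟ root | j ≟ parent i | descend i
    ... | no _    | yes refl | inj₂ up   = up
    ... | no i≢r  | yes _    | inj₁ i≡r  = ⊥-elim (i≢r i≡r)

    isChild-row : ∀ i → sum (b2n ∘ isChild i) + indicator root i ≡ 1
    isChild-row i with i ≟ root
    ... | yes _ = cong (_+ 1) (sum-zero n)
    ... | no _  = cong (_+ 0) (sum-indicator (parent i))

    isChild-pair : ∀ i j → b2n (isChild i j) + b2n (isChild j i) ≤ b2n (adj T i j)
    isChild-pair i j with isChild i j in ij | isChild j i in ji
    ... | false | false = z≤n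
    ... | true  | true  = ⊥-elim (<-asym (proj₂ (isChild⇒ i j ij)) (proj₂ (isChild⇒ j i ji)))
    ... | true  | false rewrite proj₁ (isChild⇒ i j ij) = ≤-refl
    ... | false | true  rewrite Graph.sym T i j | proj₁ (isChild⇒ j i ji) = ≤-refl

    child : Fin n → Fin n → ℕ
    child i j = b2n (isChild i j)

    children+1≡n : sum² child + 1 ≡ n
    children+1≡n = begin
      sum² child + 1                               ≡⟨ cong (sum² child +_) (sum-indicator root) ⟨
      sum² child + sum (indicator root)            ≡⟨ ∑-distrib-+ (λ i → sum (child i)) (indicator root) ⟨
      sum (λ i → sum (child i) + indicator root i) ≡⟨ sum-cong-≗ isChild-row ⟩
      sum {n} (const 1)                            ≡⟨ trans (sum-const n 1) (*-identityʳ n) ⟩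
      n                                            ∎
      where open ≡-Reasoning

  -- Each non-root vertex contributes its parent edge, and no edge is contributed twice.
  ranking⇒edge-lower-bound : n + n ≤ sum (deg T) + 2
  ranking⇒edge-lower-bound = begin
    n + n                                              ≡⟨ cong₂ _+_ children+1≡n children+1≡n ⟨
    (sum² child + 1) + (sum² child + 1)                ≡⟨ regroup (sum² child) ⟩
    sum² child + sum² child + 2                        ≡⟨ cong (λ x → sum² child + x + 2) (∑-comm child) ⟩
    sum² child + sum² (λ i j → child j i) + 2          ≡⟨ cong (_+ 2) (sum²-distrib-+ child (λ i j → child j i)) ⟨
    sum² (λ i j → child i j + child j i) + 2           ≤⟨ +-monoˡ-≤ 2 (sum-mono-≤ (λ i → sum-mono-≤ (isChild-pair i))) ⟩
    sum (deg T) + 2                                    ∎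
    where
    open ≤-Reasoning
    regroup : ∀ a → (a + 1) + (a + 1) ≡ a + a + 2
    regroup = solve-∀

module _ {n} {T : Graph n} (connected : Connected T) (r : Fin n) where
  private
    WithinSteps : ℕ → Fin n → Set
    WithinSteps zero    v = v ≡ r
    WithinSteps (suc k) v = WithinSteps k v ⊎ ∃ λ u → Edge T v u × WithinSteps k u

    withinSteps? : ∀ k v → Dec (WithinSteps k v)
    withinSteps? zero    v = v ≟ r
    withinSteps? (suc k) v = withinSteps? k v ⊎-dec any? (λ u → (adj T v u Bool.≟ true) ×-dec withinSteps? k u)

    walk⇒withinSteps : ∀ {v} → Walk T v r → ∃ λ k → WithinSteps k v
    walk⇒withinSteps here       = 0 , refl
    walk⇒withinSteps (step e p) with walk⇒withinSteps p
    ... | k , within = suc k , inj₂ (_ , e , within)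

    closest : ∀ v → Σ ℕ λ m → WithinSteps m v × (∀ j → j < m → ¬ WithinSteps j v)
    closest v = least-witness (λ k → withinSteps? k v) _ (proj₂ (walk⇒withinSteps (connected v r)))

    distance : Fin n → ℕ
    distance v = proj₁ (closest v)

    distance-minimal : ∀ v k → WithinSteps k v → distance v ≤ k
    distance-minimal v k within = ≮⇒≥ (λ k<d → proj₂ (proj₂ (closest v)) k k<d within)

    towardsRoot : ∀ v → v ≡ r ⊎ Σ (Fin n) λ u → Edge T v u × distance u < distance v
    towardsRoot v with closest v
    ... | zero  , v≡r , _                        = inj₁ v≡r
    ... | suc m , inj₁ within , notCloser        = ⊥-elim (notCloser m ≤-refl within)
    ... | suc m , inj₂ (u , vu , within) , _     = inj₂ (u , vu , s≤s (distance-minimal u m within))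

    parent : Fin n → Fin n
    parent v with towardsRoot v
    ... | inj₁ _       = v
    ... | inj₂ (u , _) = u

    descend : ∀ v → v ≡ r ⊎ (Edge T v (parent v) × distance (parent v) < distance v)
    descend v with towardsRoot v
    ... | inj₁ v≡r            = inj₁ v≡r
    ... | inj₂ (_ , vu , d<d) = inj₂ (vu , d<d)

  connected⇒ranking : RootedRanking T
  connected⇒ranking = record { rank = distance ; root = r ; parent = parent ; descend = descend }

connected⇒edge-lower-bound : ∀ {n} (T : Graph (suc n)) → Connected T → suc n + suc n ≤ sum (deg T) + 2
connected⇒edge-lower-bound T connected = ranking⇒edge-lower-bound (connected⇒ranking connected fzero)

module _ {n} {T : Graph n} (R : RootedRanking T) where
  open RootedRanking R

  private
    walkToRoot′ : ∀ v → Acc _<_ (rank v) → Walk T v root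
    walkToRoot′ v (acc smaller) with descend v
    ... | inj₁ refl            = here
    ... | inj₂ (v↦p , p<v)    = step v↦p (walkToRoot′ (parent v) (smaller p<v))

  ranking⇒connected : Connected T
  ranking⇒connected u v = walkToRoot′ u (<-wellFounded _) ++ʷ reverseʷ (walkToRoot′ v (<-wellFounded _))

-- Unlike acyclicity, this certificate of being a tree is easily preserved by attaching leaves and
-- subdividing edges.
record RankedTree {n} (T : Graph n) : Set where
  field
    ranking : RootedRanking T
  open RootedRanking ranking public
  field
    adjacent-rank≢ : ∀ u v → Edge T u v → ¬ rank u ≡ rank v
    lower-unique   : ∀ v u w → Edge T v u → Edge T v w → rank u < rank v → rank w < rank v → u ≡ w

argmax : ∀ {n} (f : Fin (suc n) → ℕ) → Σ (Fin (suc n)) λ i → ∀ j → f j ≤ f i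
argmax {zero}  f = fzero , λ { fzero → ≤-refl }
argmax {suc n} f with argmax (f ∘ fsuc)
... | i , max with f fzero ≤? f (fsuc i)
...   | yes f0≤fi = fsuc i , λ { fzero → f0≤fi ; (fsuc j) → max j }
...   | no  f0≰fi = fzero  , λ { fzero → ≤-refl ; (fsuc j) → ≤-trans (max j) (<⇒≤ (≰⇒> f0≰fi)) }

lastView : ∀ {m} (j : Fin (suc m)) → j ≡ fromℕ m ⊎ Σ (Fin m) λ j′ → j ≡ inject₁ j′
lastView {zero}  fzero    = inj₁ refl
lastView {suc m} fzero    = inj₂ (fzero , refl)
lastView {suc m} (fsuc j) with lastView j
... | inj₁ refl         = inj₁ refl
... | inj₂ (j′ , refl)  = inj₂ (fsuc j′ , refl)

cycle-neighbours : ∀ {n k} {T : Graph n} (C : Cycle T k) i → let open Cycle C in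
  Σ _ λ s → Σ _ λ p → ¬ s ≡ p × Edge T (vtx i) (vtx s) × Edge T (vtx i) (vtx p)
cycle-neighbours {T = T} C fzero = _ , _ , (λ ()) , cons fzero , Edge-sym T close
  where open Cycle C
cycle-neighbours {k = k} {T = T} C (fsuc j) with lastView j
... | inj₁ refl        = _ , _ , (λ ()) , close , Edge-sym T (cons (fromℕ (suc k)))
  where open Cycle C
... | inj₂ (j′ , refl) = _ , _ , apart , cons (fsuc j′) , Edge-sym T (cons (inject₁ j′))
  where
  open Cycle C
  apart : ¬ fsuc (fsuc j′) ≡ inject₁ (inject₁ j′)
  apart eq = 1+n≰n (≤-trans (n≤1+n _) (≤-reflexive (begin
    suc (suc (toℕ j′))            ≡⟨ cong toℕ eq ⟩
    toℕ (inject₁ (inject₁ j′))    ≡⟨ trans (toℕ-inject₁ _) (toℕ-inject₁ j′) ⟩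
    toℕ j′                        ∎)))
    where open ≡-Reasoning

module _ {n} {T : Graph n} (R : RankedTree T) where
  open RankedTree R

  rankedTree⇒acyclic : Acyclic T
  rankedTree⇒acyclic k C with argmax (rank ∘ Cycle.vtx C)
  ... | top , max with cycle-neighbours C top
  ... | s , p , s≢p , top↦s , top↦p = s≢p (inj (lower-unique _ _ _ top↦s top↦p (below top↦s (max s)) (below top↦p (max p))))
    where
    open Cycle C
    below : ∀ {x} → Edge T (vtx top) (vtx x) → rank (vtx x) ≤ rank (vtx top) → rank (vtx x) < rank (vtx top)
    below e x≤top = ≤∧≢⇒< x≤top (λ eq → adjacent-rank≢ _ _ e (sym eq))

  rankedTree⇒tree : IsTree T
  rankedTree⇒tree = ranking⇒connected ranking , rankedTree⇒acyclic

-- Short cycles in a pair of trees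

Linked-lookup : ∀ {A : Set} {R : A → A → Set} {m} {xs : Vec A (suc m)} → Linked R xs →
                ∀ i → R (lookup xs (inject₁ i)) (lookup xs (fsuc i))
Linked-lookup {xs = _ ∷ _ ∷ _} (r ∷ rs) fzero    = r
Linked-lookup {xs = _ ∷ _ ∷ _} (r ∷ rs) (fsuc i) = Linked-lookup rs i

closedTrail⇒cycle : ∀ {n k} {T : Graph n} (xs : Vec (Fin n) (3 + k)) → Unique xs → Linked (Edge T) xs →
                    Edge T (lookup xs (fromℕ (2 + k))) (lookup xs fzero) → Cycle T k
closedTrail⇒cycle xs distinct trail closing = record
  { vtx = lookup xs ; inj = lookup-injective distinct _ _ ; cons = Linked-lookup trail ; close = closing }

module _ {n} {T : Graph n} where
  triangle : ∀ {x y z} → ¬ x ≡ y → ¬ x ≡ z → ¬ y ≡ z →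
             Edge T x y → Edge T y z → Edge T z x → Cycle T 0
  triangle x≢y x≢z y≢z xy yz zx =
    closedTrail⇒cycle (_ ∷ _ ∷ _ ∷ []) ((x≢y ∷ x≢z ∷ []) ∷ (y≢z ∷ []) ∷ [] ∷ []) (xy ∷ yz ∷ [-]) zx

  square : ∀ {x y z w} → ¬ x ≡ y → ¬ x ≡ z → ¬ x ≡ w → ¬ y ≡ z → ¬ y ≡ w → ¬ z ≡ w →
           Edge T x y → Edge T y z → Edge T z w → Edge T w x → Cycle T 1
  square x≢y x≢z x≢w y≢z y≢w z≢w xy yz zw wx =
    closedTrail⇒cycle (_ ∷ _ ∷ _ ∷ _ ∷ [])
      ((x≢y ∷ x≢z ∷ x≢w ∷ []) ∷ (y≢z ∷ y≢w ∷ []) ∷ (z≢w ∷ []) ∷ [] ∷ []) (xy ∷ yz ∷ zw ∷ [-]) wx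

  pentagon : ∀ {x y z w t} → ¬ x ≡ y → ¬ x ≡ z → ¬ x ≡ w → ¬ x ≡ t → ¬ y ≡ z → ¬ y ≡ w → ¬ y ≡ t →
             ¬ z ≡ w → ¬ z ≡ t → ¬ w ≡ t →
             Edge T x y → Edge T y z → Edge T z w → Edge T w t → Edge T t x → Cycle T 2
  pentagon x≢y x≢z x≢w x≢t y≢z y≢w y≢t z≢w z≢t w≢t xy yz zw wt tx =
    closedTrail⇒cycle (_ ∷ _ ∷ _ ∷ _ ∷ _ ∷ [])
      ((x≢y ∷ x≢z ∷ x≢w ∷ x≢t ∷ []) ∷ (y≢z ∷ y≢w ∷ y≢t ∷ []) ∷ (z≢w ∷ z≢t ∷ []) ∷ (w≢t ∷ []) ∷ [] ∷ [])
      (xy ∷ yz ∷ zw ∷ wt ∷ [-]) tx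

InEither : ∀ {n} → Graph n → Graph n → Fin n → Fin n → Set
InEither T₁ T₂ u v = Edge T₁ u v ⊎ Edge T₂ u v

private
  apex-over-common-path′ : ∀ {n} {T T′ : Graph n} → Acyclic T → Acyclic T′ → ∀ {v p q r} →
    ¬ v ≡ p → ¬ v ≡ q → ¬ v ≡ r → ¬ p ≡ q → ¬ p ≡ r → ¬ q ≡ r →
    CommonEdge T T′ p q → CommonEdge T T′ q r →
    InEither T T′ v p → Edge T v q → InEither T T′ v r → ⊥
  apex-over-common-path′ {T = T} acyclic _ v≢p v≢q _ p≢q _ _ (pq , _) _ (inj₁ vp) vq _ =
    acyclic 0 (triangle v≢p v≢q p≢q vp pq (Edge-sym T vq))
  apex-over-common-path′ {T = T} acyclic _ _ v≢q v≢r _ _ q≢r _ (qr , _) (inj₂ _) vq (inj₁ vr) =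
    acyclic 0 (triangle v≢q v≢r q≢r vq qr (Edge-sym T vr))
  apex-over-common-path′ {T′ = T′} _ acyclic′ v≢p v≢q v≢r p≢q p≢r q≢r (_ , pq′) (_ , qr′) (inj₂ vp′) _ (inj₂ vr′) =
    acyclic′ 1 (square v≢p v≢q v≢r p≢q p≢r q≢r vp′ pq′ qr′ (Edge-sym T′ vr′))

apex-over-common-path : ∀ {n} {T₁ T₂ : Graph n} → Acyclic T₁ → Acyclic T₂ → ∀ {v p q r} →
  ¬ v ≡ p → ¬ v ≡ q → ¬ v ≡ r → ¬ p ≡ q → ¬ p ≡ r → ¬ q ≡ r →
  CommonEdge T₁ T₂ p q → CommonEdge T₁ T₂ q r →
  InEither T₁ T₂ v p → InEither T₁ T₂ v q → InEither T₁ T₂ v r → ⊥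
apex-over-common-path ac₁ ac₂ v≢p v≢q v≢r p≢q p≢r q≢r pq qr vp (inj₁ vq) vr =
  apex-over-common-path′ ac₁ ac₂ v≢p v≢q v≢r p≢q p≢r q≢r pq qr vp vq vr
apex-over-common-path ac₁ ac₂ v≢p v≢q v≢r p≢q p≢r q≢r pq qr vp (inj₂ vq) vr =
  apex-over-common-path′ ac₂ ac₁ v≢p v≢q v≢r p≢q p≢r q≢r (×-swap pq) (×-swap qr) (⊎-swap vp) vq (⊎-swap vr)

private
  apex-over-opposite-edges′ : ∀ {n} {T T′ : Graph n} → Acyclic T → Acyclic T′ → ∀ {v a b c d} →
    ¬ v ≡ a → ¬ v ≡ b → ¬ v ≡ c → ¬ v ≡ d → ¬ a ≡ b → ¬ a ≡ c → ¬ a ≡ d → ¬ b ≡ c → ¬ b ≡ d → ¬ c ≡ d →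
    CommonEdge T T′ a b → CommonEdge T T′ c d → InEither T T′ b c → InEither T T′ d a →
    Edge T v a → Edge T′ v b → InEither T T′ v c → InEither T T′ v d → ⊥
  apex-over-opposite-edges′ {T = T} acyclic _ _ _ v≢c v≢d _ _ _ _ _ c≢d _ (cd , _) _ _ _ _ (inj₁ vc) (inj₁ vd) =
    acyclic 0 (triangle v≢c v≢d c≢d vc cd (Edge-sym T vd))
  apex-over-opposite-edges′ {T′ = T′} _ acyclic′ _ _ v≢c v≢d _ _ _ _ _ c≢d _ (_ , cd′) _ _ _ _ (inj₂ vc′) (inj₂ vd′) =
    acyclic′ 0 (triangle v≢c v≢d c≢d vc′ cd′ (Edge-sym T′ vd′))
  apex-over-opposite-edges′ {T = T} acyclic _ v≢a v≢b v≢c _ a≢b a≢c _ b≢c _ _ (ab , _) _ (inj₁ bc) _ va _ (inj₁ vc) (inj₂ _) =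
    acyclic 1 (square v≢a v≢b v≢c a≢b a≢c b≢c va ab bc (Edge-sym T vc))
  apex-over-opposite-edges′ {T′ = T′} _ acyclic′ _ v≢b v≢c v≢d _ _ _ b≢c b≢d c≢d _ (_ , cd′) (inj₂ bc′) _ _ vb (inj₁ _) (inj₂ vd′) =
    acyclic′ 1 (square v≢b v≢c v≢d b≢c b≢d c≢d vb bc′ cd′ (Edge-sym T′ vd′))
  apex-over-opposite-edges′ {T = T} acyclic _ v≢a _ _ v≢d _ _ a≢d _ _ _ _ _ _ (inj₁ da) va _ (inj₂ _) (inj₁ vd) =
    acyclic 0 (triangle v≢a v≢d a≢d va (Edge-sym T da) (Edge-sym T vd))
  apex-over-opposite-edges′ {T′ = T′} _ acyclic′ v≢a v≢b v≢c v≢d a≢b a≢c a≢d b≢c b≢d c≢d (_ , ab′) (_ , cd′) _ (inj₂ da′) _ vb (inj₂ vc′) (inj₁ _) =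
    acyclic′ 2 (pentagon v≢b v≢a v≢d v≢c (a≢b ∘ sym) b≢d b≢c a≢d a≢c (c≢d ∘ sym)
                     vb (Edge-sym T′ ab′) (Edge-sym T′ da′) (Edge-sym T′ cd′) (Edge-sym T′ vc′))

apex-over-opposite-edges : ∀ {n} {T₁ T₂ : Graph n} → Acyclic T₁ → Acyclic T₂ → ∀ {v a b c d} →
  ¬ v ≡ a → ¬ v ≡ b → ¬ v ≡ c → ¬ v ≡ d → ¬ a ≡ b → ¬ a ≡ c → ¬ a ≡ d → ¬ b ≡ c → ¬ b ≡ d → ¬ c ≡ d →
  CommonEdge T₁ T₂ a b → CommonEdge T₁ T₂ c d → InEither T₁ T₂ b c → InEither T₁ T₂ d a →
  InEither T₁ T₂ v a → InEither T₁ T₂ v b → InEither T₁ T₂ v c → InEither T₁ T₂ v d → ⊥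
apex-over-opposite-edges {T₁ = T₁} ac₁ _ v≢a v≢b _ _ a≢b _ _ _ _ _ (ab₁ , _) _ _ _ (inj₁ va) (inj₁ vb) _ _ =
  ac₁ 0 (triangle v≢a v≢b a≢b va ab₁ (Edge-sym T₁ vb))
apex-over-opposite-edges {T₂ = T₂} _ ac₂ v≢a v≢b _ _ a≢b _ _ _ _ _ (_ , ab₂) _ _ _ (inj₂ va) (inj₂ vb) _ _ =
  ac₂ 0 (triangle v≢a v≢b a≢b va ab₂ (Edge-sym T₂ vb))
apex-over-opposite-edges ac₁ ac₂ v≢a v≢b v≢c v≢d a≢b a≢c a≢d b≢c b≢d c≢d ab cd bc da (inj₁ va) (inj₂ vb) vc vd =
  apex-over-opposite-edges′ ac₁ ac₂ v≢a v≢b v≢c v≢d a≢b a≢c a≢d b≢c b≢d c≢d ab cd bc da va vb vc vd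
apex-over-opposite-edges ac₁ ac₂ v≢a v≢b v≢c v≢d a≢b a≢c a≢d b≢c b≢d c≢d ab cd bc da (inj₂ va) (inj₁ vb) vc vd =
  apex-over-opposite-edges′ ac₂ ac₁ v≢a v≢b v≢c v≢d a≢b a≢c a≢d b≢c b≢d c≢d (×-swap ab) (×-swap cd)
    (⊎-swap bc) (⊎-swap da) va vb (⊎-swap vc) (⊎-swap vd)

-- Necessity of the degree conditions

pairIndicator : ∀ {n} → Fin n → Fin n → Fin n → Fin n → ℕ
pairIndicator p q u v = b2n (does (u ≟ p) ∧ does (v ≟ q))

sum²-pairIndicator : ∀ {n} (p q : Fin n) → sum² (pairIndicator p q) ≡ 1
sum²-pairIndicator {n} p q = trans (sum-cong-≗ row) (sum-indicator p)
  where
  row : ∀ u → sum (pairIndicator p q u) ≡ indicator p u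
  row u with u ≟ p
  ... | yes _ = sum-indicator q
  ... | no _  = sum-zero n

edgeIndicator : ∀ {n} → Fin n × Fin n → Fin n → Fin n → ℕ
edgeIndicator (p , q) u v = pairIndicator p q u v + pairIndicator q p u v

sum²-edgeIndicator : ∀ {n} (e : Fin n × Fin n) → sum² (edgeIndicator e) ≡ 2
sum²-edgeIndicator (p , q) =
  trans (sum²-distrib-+ (pairIndicator p q) (pairIndicator q p)) (cong₂ _+_ (sum²-pairIndicator p q) (sum²-pairIndicator q p))

sameEdge⇒edgeIndicator : ∀ {n} {u v : Fin n} e → SameEdge u v e → 1 ≤ edgeIndicator e u v
sameEdge⇒edgeIndicator {u = u} {v} _ (inj₁ (refl , refl)) rewrite dec-true (u ≟ u) refl | dec-true (v ≟ v) refl = s≤s z≤n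
sameEdge⇒edgeIndicator {u = u} {v} _ (inj₂ (refl , refl)) rewrite dec-true (u ≟ u) refl | dec-true (v ≟ v) refl = m≤n+m 1 _

-- Each tree has at least n - 1 edges and they share at most two, which already accounts for all
-- 2n - 4 edges of G.
module _ {m} {G T₁ T₂ : Graph (suc m)}
         (T₁⊆G : ∀ u v → Edge T₁ u v → Edge G u v) (connected₁ : Connected T₁)
         (T₂⊆G : ∀ u v → Edge T₂ u v → Edge G u v) (connected₂ : Connected T₂)
         (e₁ e₂ : Fin (suc m) × Fin (suc m))
         (common⊆ : ∀ u v → CommonEdge T₁ T₂ u v → SameEdge u v e₁ ⊎ SameEdge u v e₂)
         (size : edgeCount G + 4 ≡ 2 * suc m) where

  private
    n : ℕ
    n = suc m

    inTrees inGraph : Fin n → Fin n → ℕ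
    inTrees u v = b2n (adj T₁ u v) + b2n (adj T₂ u v)
    inGraph u v = b2n (adj G u v) + (edgeIndicator e₁ u v + edgeIndicator e₂ u v)

    inTrees≤inGraph : ∀ u v → inTrees u v ≤ inGraph u v
    inTrees≤inGraph u v with adj T₁ u v in uv₁ | adj T₂ u v in uv₂
    ... | false | false = z≤n
    ... | true  | false rewrite T₁⊆G u v uv₁ = s≤s z≤n
    ... | false | true  rewrite T₂⊆G u v uv₂ = s≤s z≤n
    ... | true  | true  rewrite T₁⊆G u v uv₁ with common⊆ u v (uv₁ , uv₂)
    ...   | inj₁ same = s≤s (≤-trans (sameEdge⇒edgeIndicator e₁ same) (m≤m+n _ (edgeIndicator e₂ u v)))
    ...   | inj₂ same = s≤s (≤-trans (sameEdge⇒edgeIndicator e₂ same) (m≤n+m _ (edgeIndicator e₁ u v)))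

    sum²-inGraph : sum² inGraph ≡ edgeCount G + edgeCount G + 4
    sum²-inGraph = begin
      sum² inGraph                                                      ≡⟨ sum²-distrib-+ (λ u v → b2n (adj G u v)) (λ u v → edgeIndicator e₁ u v + edgeIndicator e₂ u v) ⟩
      sum (deg G) + sum² (λ u v → edgeIndicator e₁ u v + edgeIndicator e₂ u v) ≡⟨ cong (sum (deg G) +_) (sum²-distrib-+ (edgeIndicator e₁) (edgeIndicator e₂)) ⟩
      sum (deg G) + (sum² (edgeIndicator e₁) + sum² (edgeIndicator e₂)) ≡⟨ cong₂ _+_ (handshake G) (sym (cong₂ _+_ (sum²-edgeIndicator e₁) (sum²-edgeIndicator e₂))) ⟨
      edgeCount G + edgeCount G + 4                                     ∎
      where open ≡-Reasoning

    counting : ∀ D₁ D₂ S E → n + n ≤ D₁ + 2 → n + n ≤ D₂ + 2 → D₁ + D₂ < S → S ≡ E + E + 4 → E + 4 ≡ 2 * n → ⊥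
    counting D₁ D₂ S E lower₁ lower₂ D<S S≡ E≡ = <-irrefl refl (begin-strict
      (n + n) + (n + n)    ≤⟨ +-mono-≤ lower₁ lower₂ ⟩
      (D₁ + 2) + (D₂ + 2)  ≡⟨ regroup₁ D₁ D₂ ⟩
      (D₁ + D₂) + 4        <⟨ +-monoˡ-< 4 D<S ⟩
      S + 4                ≡⟨ cong (_+ 4) S≡ ⟩
      E + E + 4 + 4        ≡⟨ regroup₂ E ⟩
      (E + 4) + (E + 4)    ≡⟨ cong₂ _+_ E≡ E≡ ⟩
      2 * n + 2 * n        ≡⟨ regroup₃ n ⟩
      (n + n) + (n + n)    ∎)
      where
      open ≤-Reasoning
      regroup₁ : ∀ x y → (x + 2) + (y + 2) ≡ (x + y) + 4
      regroup₁ = solve-∀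
      regroup₂ : ∀ x → x + x + 4 + 4 ≡ (x + 4) + (x + 4)
      regroup₂ = solve-∀
      regroup₃ : ∀ x → 2 * x + 2 * x ≡ (x + x) + (x + x)
      regroup₃ = solve-∀

  edges-in-either-tree : ∀ x y → Edge G x y → InEither T₁ T₂ x y
  edges-in-either-tree x y xy with adj T₁ x y in xy₁ | adj T₂ x y in xy₂
  ... | true  | _     = inj₁ refl
  ... | false | true  = inj₂ refl
  ... | false | false = ⊥-elim (counting (sum (deg T₁)) (sum (deg T₂)) (sum² inGraph) (edgeCount G)
          (connected⇒edge-lower-bound T₁ connected₁) (connected⇒edge-lower-bound T₂ connected₂)
          strict sum²-inGraph size)
    where
    missed : inTrees x y < inGraph x y
    missed rewrite xy₁ | xy₂ | xy = s≤s z≤n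
    strict : sum (deg T₁) + sum (deg T₂) < sum² inGraph
    strict = subst (_< sum² inGraph) (sum²-distrib-+ (λ u v → b2n (adj T₁ u v)) (λ u v → b2n (adj T₂ u v)))
      (sum-mono-< (λ u → sum-mono-≤ (inTrees≤inGraph u)) x (sum-mono-< (inTrees≤inGraph x) y missed))

two-spanning-trees⇒deg≥2 : ∀ {n} {G T₁ T₂ : Graph n} →
  (∀ u v → Edge T₁ u v → Edge G u v) → Connected T₁ → (∀ u v → Edge T₂ u v → Edge G u v) → Connected T₂ →
  ∀ {p q} → CommonEdge T₁ T₂ p q → (∀ u v → CommonEdge T₁ T₂ u v → 2 ≤ deg G u) → ∀ u → 2 ≤ deg G u
two-spanning-trees⇒deg≥2 {G = G} T₁⊆G connected₁ T₂⊆G connected₂ {p} {q} pq common⇒deg≥2 u with u ≟ p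
... | yes refl = common⇒deg≥2 u q pq
... | no u≢p with firstStep u≢p (connected₁ u p) | firstStep u≢p (connected₂ u p)
...   | x , ux₁ | y , uy₂ with x ≟ y
...     | no x≢y   = two-neighbours⇒deg≥2 G x≢y (T₁⊆G u x ux₁) (T₂⊆G u y uy₂)
...     | yes refl = common⇒deg≥2 u x (ux₁ , uy₂)

OnC4 : ∀ {n} → Fin n → Fin n → Fin n → Fin n → Fin n → Set
OnC4 a b c d u = u ≡ a ⊎ u ≡ b ⊎ u ≡ c ⊎ u ≡ d

module _ {n} {a b c d : Fin n} where
  a-on-C4 : OnC4 a b c d a
  a-on-C4 = inj₁ refl

  b-on-C4 : OnC4 a b c d b
  b-on-C4 = inj₂ (inj₁ refl)

  c-on-C4 : OnC4 a b c d c
  c-on-C4 = inj₂ (inj₂ (inj₁ refl))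

  d-on-C4 : OnC4 a b c d d
  d-on-C4 = inj₂ (inj₂ (inj₂ refl))

sameEdge⇒OnC4 : ∀ {n} {a b c d u v : Fin n} k → SameEdge u v (c4Edge a b c d k) → OnC4 a b c d u
sameEdge⇒OnC4 0F (inj₁ (refl , _)) = a-on-C4
sameEdge⇒OnC4 0F (inj₂ (refl , _)) = b-on-C4
sameEdge⇒OnC4 1F (inj₁ (refl , _)) = b-on-C4
sameEdge⇒OnC4 1F (inj₂ (refl , _)) = c-on-C4
sameEdge⇒OnC4 2F (inj₁ (refl , _)) = c-on-C4
sameEdge⇒OnC4 2F (inj₂ (refl , _)) = d-on-C4
sameEdge⇒OnC4 3F (inj₁ (refl , _)) = d-on-C4
sameEdge⇒OnC4 3F (inj₂ (refl , _)) = a-on-C4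

C4⇒deg≥2 : ∀ {n} {G : Graph n} {a b c d} → InducedC4 G a b c d → ∀ {u} → OnC4 a b c d u → 2 ≤ deg G u
C4⇒deg≥2 {G = G} (_ , a≢c , _ , _ , b≢d , _ , ab , bc , cd , da , _) (inj₁ refl) =
  two-neighbours⇒deg≥2 G b≢d ab (Edge-sym G da)
C4⇒deg≥2 {G = G} (_ , a≢c , _ , _ , b≢d , _ , ab , bc , cd , da , _) (inj₂ (inj₁ refl)) =
  two-neighbours⇒deg≥2 G a≢c (Edge-sym G ab) bc
C4⇒deg≥2 {G = G} (_ , a≢c , _ , _ , b≢d , _ , ab , bc , cd , da , _) (inj₂ (inj₂ (inj₁ refl))) =
  two-neighbours⇒deg≥2 G b≢d (Edge-sym G bc) cd
C4⇒deg≥2 {G = G} (_ , a≢c , _ , _ , b≢d , _ , ab , bc , cd , da , _) (inj₂ (inj₂ (inj₂ refl))) =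
  two-neighbours⇒deg≥2 G (a≢c ∘ sym) (Edge-sym G cd) da

dominating-vertex-off-C4 : ∀ {n} {G : Graph n} {a b c d v} → InducedC4 G a b c d → (∀ w → ¬ w ≡ v → Edge G v w) →
  ¬ v ≡ a × ¬ v ≡ b × ¬ v ≡ c × ¬ v ≡ d
dominating-vertex-off-C4 {G = G} {a} {b} {c} {d} (_ , a≢c , _ , _ , b≢d , _ , _ , _ , _ , _ , ac∉G , bd∉G) v-adj =
  (λ { refl → true≢false (trans (sym (v-adj c (a≢c ∘ sym))) ac∉G) }) ,
  (λ { refl → true≢false (trans (sym (v-adj d (b≢d ∘ sym))) bd∉G) }) ,
  (λ { refl → true≢false (trans (sym (Edge-sym G (v-adj a a≢c))) ac∉G) }) ,
  (λ { refl → true≢false (trans (sym (Edge-sym G (v-adj b b≢d))) bd∉G) })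

two-common-C4-edges⇒no-dominating-vertex : ∀ {m} {G T₁ T₂ : Graph (suc m)} → Acyclic T₁ → Acyclic T₂ →
  (∀ x y → Edge G x y → InEither T₁ T₂ x y) → ∀ {a b c d} → InducedC4 G a b c d →
  ExactlyTwoCommonCycleEdges T₁ T₂ a b c d → ∀ v → ¬ deg G v ≡ m
two-common-C4-edges⇒no-dominating-vertex {G = G} {T₁} {T₂} acyclic₁ acyclic₂ G⊆T₁∪T₂ {a} {b} {c} {d}
  C4@(a≢b , a≢c , a≢d , b≢c , b≢d , c≢d , ab , bc , cd , da , _) (i , j , i≢j , common-i , common-j , _) v deg≡m
  with dominating-vertex-off-C4 {G = G} C4 (deg≡max⇒adjacent G v deg≡m)
... | v≢a , v≢b , v≢c , v≢d = two-common i j i≢j (common-i refl) (common-j refl)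
  where
  sees : ∀ {w} → ¬ v ≡ w → InEither T₁ T₂ v w
  sees {w} v≢w = G⊆T₁∪T₂ v w (deg≡max⇒adjacent G v deg≡m w (v≢w ∘ sym))

  path : ∀ {p q r} → ¬ v ≡ p → ¬ v ≡ q → ¬ v ≡ r → ¬ p ≡ q → ¬ p ≡ r → ¬ q ≡ r →
         CommonEdge T₁ T₂ p q → CommonEdge T₁ T₂ q r → ⊥
  path v≢p v≢q v≢r p≢q p≢r q≢r pq qr =
    apex-over-common-path acyclic₁ acyclic₂ v≢p v≢q v≢r p≢q p≢r q≢r pq qr (sees v≢p) (sees v≢q) (sees v≢r)

  ab∣cd : CommonEdge T₁ T₂ a b → CommonEdge T₁ T₂ c d → ⊥
  ab∣cd ab₁₂ cd₁₂ = apex-over-opposite-edges acyclic₁ acyclic₂ v≢a v≢b v≢c v≢d a≢b a≢c a≢d b≢c b≢d c≢d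
    ab₁₂ cd₁₂ (G⊆T₁∪T₂ b c bc) (G⊆T₁∪T₂ d a da) (sees v≢a) (sees v≢b) (sees v≢c) (sees v≢d)
  bc∣da : CommonEdge T₁ T₂ b c → CommonEdge T₁ T₂ d a → ⊥
  bc∣da bc₁₂ da₁₂ = apex-over-opposite-edges acyclic₁ acyclic₂ v≢b v≢c v≢d v≢a b≢c b≢d (a≢b ∘ sym) c≢d (a≢c ∘ sym) (a≢d ∘ sym)
    bc₁₂ da₁₂ (G⊆T₁∪T₂ c d cd) (G⊆T₁∪T₂ a b ab) (sees v≢b) (sees v≢c) (sees v≢d) (sees v≢a)

  Common : Fin 4 → Set
  Common k = CommonEdge T₁ T₂ (proj₁ (c4Edge a b c d k)) (proj₂ (c4Edge a b c d k))

  two-common : ∀ k l → ¬ k ≡ l → Common k → Common l → ⊥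
  two-common 0F 0F k≢l = ⊥-elim (k≢l refl)
  two-common 1F 1F k≢l = ⊥-elim (k≢l refl)
  two-common 2F 2F k≢l = ⊥-elim (k≢l refl)
  two-common 3F 3F k≢l = ⊥-elim (k≢l refl)
  two-common 0F 1F _ x y = path v≢a v≢b v≢c a≢b a≢c b≢c x y
  two-common 1F 0F _ x y = path v≢a v≢b v≢c a≢b a≢c b≢c y x
  two-common 1F 2F _ x y = path v≢b v≢c v≢d b≢c b≢d c≢d x y
  two-common 2F 1F _ x y = path v≢b v≢c v≢d b≢c b≢d c≢d y x
  two-common 2F 3F _ x y = path v≢c v≢d v≢a c≢d (a≢c ∘ sym) (a≢d ∘ sym) x y
  two-common 3F 2F _ x y = path v≢c v≢d v≢a c≢d (a≢c ∘ sym) (a≢d ∘ sym) y x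
  two-common 3F 0F _ x y = path v≢d v≢a v≢b (a≢d ∘ sym) (b≢d ∘ sym) a≢b x y
  two-common 0F 3F _ x y = path v≢d v≢a v≢b (a≢d ∘ sym) (b≢d ∘ sym) a≢b y x
  two-common 0F 2F _ x y = ab∣cd x y
  two-common 2F 0F _ x y = ab∣cd y x
  two-common 1F 3F _ x y = bc∣da x y
  two-common 3F 1F _ x y = bc∣da y x

half-edges : ∀ E m → E + 4 ≡ 2 * suc m → E + E + 4 ≡ 4 * m
half-edges E m E+4≡ = +-cancelʳ-≡ 4 (E + E + 4) (4 * m) (begin
  E + E + 4 + 4          ≡⟨ regroup E ⟩
  (E + 4) + (E + 4)      ≡⟨ cong₂ _+_ E+4≡ E+4≡ ⟩
  2 * suc m + 2 * suc m  ≡⟨ double m ⟩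
  4 * m + 4              ∎)
  where
  open ≡-Reasoning
  regroup : ∀ x → x + x + 4 + 4 ≡ (x + 4) + (x + 4)
  regroup = solve-∀
  double : ∀ x → 2 * suc x + 2 * suc x ≡ 4 * x + 4
  double = solve-∀

pivotable⇒degree-conditions : ∀ {m} (G : Graph (suc m)) → C4Pivotable G →
  (sum (deg G) + 4 ≡ 4 * m) × (∀ v → deg G v < m) × (∀ v → 2 ≤ deg G v)
pivotable⇒degree-conditions {m} G
  (size , a , b , c , d , C4 , T₁ , T₂ , (T₁⊆G , connected₁ , acyclic₁) , (T₂⊆G , connected₂ , acyclic₂) ,
   two-common@(i , j , _ , common-i , _ , common⊆)) =
  degree-sum , (λ v → ≤∧≢⇒< (deg≤ G v) (no-dominating v)) ,
  two-spanning-trees⇒deg≥2 {G = G} T₁⊆G connected₁ T₂⊆G connected₂ (common-i refl) common⇒deg≥2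
  where
  degree-sum : sum (deg G) + 4 ≡ 4 * m
  degree-sum = trans (cong (_+ 4) (sym (handshake G))) (half-edges (edgeCount G) m size)

  no-dominating : ∀ v → ¬ deg G v ≡ m
  no-dominating = two-common-C4-edges⇒no-dominating-vertex {G = G} acyclic₁ acyclic₂
    (edges-in-either-tree {G = G} T₁⊆G connected₁ T₂⊆G connected₂ (c4Edge a b c d i) (c4Edge a b c d j) common⊆ size)
    C4 two-common

  common⇒deg≥2 : ∀ u v → CommonEdge T₁ T₂ u v → 2 ≤ deg G u
  common⇒deg≥2 u v uv with common⊆ u v uv
  ... | inj₁ same = C4⇒deg≥2 {G = G} C4 (sameEdge⇒OnC4 {a = a} {b} {c} {d} i same)
  ... | inj₂ same = C4⇒deg≥2 {G = G} C4 (sameEdge⇒OnC4 {a = a} {b} {c} {d} j same)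

-- Graph operations

_∪_ : ∀ {n} → Graph n → Graph n → Graph n
G ∪ H = record
  { adj    = λ i j → adj G i j ∨ adj H i j
  ; sym    = λ i j → cong₂ _∨_ (Graph.sym G i j) (Graph.sym H i j)
  ; irrefl = λ i → cong₂ _∨_ (Graph.irrefl G i) (Graph.irrefl H i) }

extend : ∀ {n} → Graph n → (Fin n → Bool) → Graph (suc n)
extend {n} G nbr = record { adj = adj′ ; sym = sym′ ; irrefl = irrefl′ }
  where
  adj′ : Fin (suc n) → Fin (suc n) → Bool
  adj′ fzero    fzero    = false
  adj′ fzero    (fsuc j) = nbr j
  adj′ (fsuc i) fzero    = nbr i
  adj′ (fsuc i) (fsuc j) = adj G i j
  sym′ : ∀ i j → adj′ i j ≡ adj′ j i
  sym′ fzero    fzero    = refl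
  sym′ fzero    (fsuc j) = refl
  sym′ (fsuc i) fzero    = refl
  sym′ (fsuc i) (fsuc j) = Graph.sym G i j
  irrefl′ : ∀ i → adj′ i i ≡ false
  irrefl′ fzero    = refl
  irrefl′ (fsuc i) = Graph.irrefl G i

isPair : ∀ {n} → Fin n → Fin n → Fin n → Fin n → Bool
isPair p q i j = (does (i ≟ p) ∧ does (j ≟ q)) ∨ (does (i ≟ q) ∧ does (j ≟ p))

isPair-sym : ∀ {n} (p q i j : Fin n) → isPair p q i j ≡ isPair p q j i
isPair-sym p q i j = trans (cong₂ _∨_ (∧-comm (does (i ≟ p)) _) (∧-comm (does (i ≟ q)) _))
                           (∨-comm (does (j ≟ q) ∧ does (i ≟ p)) _)

deleteEdge : ∀ {n} → Graph n → Fin n → Fin n → Graph n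
deleteEdge G p q = record
  { adj    = λ i j → adj G i j ∧ not (isPair p q i j)
  ; sym    = λ i j → cong₂ (λ x y → x ∧ not y) (Graph.sym G i j) (isPair-sym p q i j)
  ; irrefl = λ i → cong (_∧ not (isPair p q i i)) (Graph.irrefl G i) }

permute : ∀ {n} → Permutation′ n → Graph n → Graph n
permute π G = record
  { adj    = λ i j → adj G (π ⟨$⟩ʳ i) (π ⟨$⟩ʳ j)
  ; sym    = λ i j → Graph.sym G (π ⟨$⟩ʳ i) (π ⟨$⟩ʳ j)
  ; irrefl = λ i → Graph.irrefl G (π ⟨$⟩ʳ i) }

⁅_⁆ : ∀ {n} → Fin n → Fin n → Bool
⁅ p ⁆ j = does (j ≟ p)

⁅_⁆∨⁅_⁆ : ∀ {n} → Fin n → Fin n → Fin n → Bool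
⁅ p ⁆∨⁅ q ⁆ j = does (j ≟ p) ∨ does (j ≟ q)

addLeaf-ranked : ∀ {n} {T : Graph n} → RankedTree T → ∀ p → RankedTree (extend T ⁅ p ⁆)
addLeaf-ranked {n} {T} R p = record
  { ranking        = record { rank = rank′ ; root = fsuc root ; parent = parent′ ; descend = descend′ }
  ; adjacent-rank≢ = adjacent′
  ; lower-unique   = lower′ }
  where
  open RankedTree R
  T′ : Graph (suc n)
  T′ = extend T ⁅ p ⁆

  rank′ : Fin (suc n) → ℕ
  rank′ fzero    = suc (rank p)
  rank′ (fsuc v) = rank v

  parent′ : Fin (suc n) → Fin (suc n)
  parent′ fzero    = fsuc p
  parent′ (fsuc v) = fsuc (parent v)

  descend′ : ∀ v → v ≡ fsuc root ⊎ (Edge T′ v (parent′ v) × rank′ (parent′ v) < rank′ v)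
  descend′ fzero    = inj₂ (dec-true (p ≟ p) refl , ≤-refl)
  descend′ (fsuc v) with descend v
  ... | inj₁ refl = inj₁ refl
  ... | inj₂ up   = inj₂ up

  adjacent′ : ∀ u v → Edge T′ u v → ¬ rank′ u ≡ rank′ v
  adjacent′ fzero    (fsuc v) e with ≟-true⇒≡ v p e
  ... | refl = 1+n≢n
  adjacent′ (fsuc u) fzero    e with ≟-true⇒≡ u p e
  ... | refl = 1+n≢n ∘ sym
  adjacent′ (fsuc u) (fsuc v) e = adjacent-rank≢ u v e

  lower′ : ∀ v u w → Edge T′ v u → Edge T′ v w → rank′ u < rank′ v → rank′ w < rank′ v → u ≡ w
  lower′ fzero    (fsuc u) (fsuc w) vu vw _ _ = cong fsuc (trans (≟-true⇒≡ u p vu) (sym (≟-true⇒≡ w p vw)))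
  lower′ (fsuc v) fzero    _        vu _  u<v _ with ≟-true⇒≡ v p vu
  ... | refl = ⊥-elim (<-asym u<v ≤-refl)
  lower′ (fsuc v) (fsuc u) fzero    _  vw _ w<v with ≟-true⇒≡ v p vw
  ... | refl = ⊥-elim (<-asym w<v ≤-refl)
  lower′ (fsuc v) (fsuc u) (fsuc w) vu vw u<v w<v = cong fsuc (lower-unique v u w vu vw u<v w<v)

isPair-true : ∀ {n} (p q i j : Fin n) → isPair p q i j ≡ true → (i ≡ p × j ≡ q) ⊎ (i ≡ q × j ≡ p)
isPair-true p q i j eq with i ≟ p | j ≟ q | i ≟ q | j ≟ p
... | yes i≡p | yes j≡q | _      | _      = inj₁ (i≡p , j≡q)
... | _       | _       | yes i≡q | yes j≡p = inj₂ (i≡q , j≡p)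
isPair-true p q i j () | no _  | _      | no _   | _
isPair-true p q i j () | no _  | _      | yes _  | no _
isPair-true p q i j () | yes _ | no _   | no _   | _
isPair-true p q i j () | yes _ | no _   | yes _  | no _

isPair-false : ∀ {n} (p q i j : Fin n) → ¬ (i ≡ p × j ≡ q) → ¬ (i ≡ q × j ≡ p) → isPair p q i j ≡ false
isPair-false p q i j ¬pq ¬qp with isPair p q i j in eq
... | false = refl
... | true with isPair-true p q i j eq
...   | inj₁ pq = ⊥-elim (¬pq pq)
...   | inj₂ qp = ⊥-elim (¬qp qp)

isPair-swapped : ∀ {n} (p q : Fin n) → isPair p q q p ≡ true
isPair-swapped p q rewrite dec-true (q ≟ q) refl | dec-true (p ≟ p) refl = ∨-zeroʳ _

⁅p⁆∨⁅q⁆-left : ∀ {n} (p q : Fin n) → ⁅ p ⁆∨⁅ q ⁆ p ≡ true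
⁅p⁆∨⁅q⁆-left p q rewrite dec-true (p ≟ p) refl = refl

⁅p⁆∨⁅q⁆-right : ∀ {n} (p q : Fin n) → ⁅ p ⁆∨⁅ q ⁆ q ≡ true
⁅p⁆∨⁅q⁆-right p q rewrite dec-true (q ≟ q) refl = ∨-zeroʳ _

⁅p⁆∨⁅q⁆-true : ∀ {n} {p q : Fin n} j → ⁅ p ⁆∨⁅ q ⁆ j ≡ true → j ≡ p ⊎ j ≡ q
⁅p⁆∨⁅q⁆-true {p = p} {q} j eq with j ≟ p | j ≟ q
... | yes j≡p | _       = inj₁ j≡p
... | no _    | yes j≡q = inj₂ j≡q

-- Old ranks are doubled and the new vertex gets the odd rank just above p, below q; parity keeps
-- adjacent ranks distinct.
subdivide-ranked : ∀ {n} {T : Graph n} (R : RankedTree T) {p q} → Edge T p q →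
                   RankedTree.rank R p < RankedTree.rank R q → RankedTree (extend (deleteEdge T p q) ⁅ p ⁆∨⁅ q ⁆)
subdivide-ranked {n} {T} R {p} {q} pq p<q = record
  { ranking        = record { rank = rank′ ; root = fsuc root ; parent = parent′ ; descend = descend′ }
  ; adjacent-rank≢ = adjacent′
  ; lower-unique   = lower′ }
  where
  open RankedTree R
  T′ : Graph (suc n)
  T′ = extend (deleteEdge T p q) ⁅ p ⁆∨⁅ q ⁆

  rank′ : Fin (suc n) → ℕ
  rank′ fzero    = suc (2 * rank p)
  rank′ (fsuc v) = 2 * rank v

  p′<new<q′ : 2 * rank p < suc (2 * rank p) × suc (2 * rank p) < 2 * rank q
  p′<new<q′ = ≤-refl , subst (_≤ 2 * rank q) (*-suc 2 (rank p)) (*-monoʳ-≤ 2 p<q)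

  old-edge : ∀ {u v} → Edge T′ (fsuc u) (fsuc v) → Edge T u v × isPair p q u v ≡ false
  old-edge {u} {v} e with adj T u v | isPair p q u v
  ... | true | false = refl , refl

  keep-edge : ∀ {u v} → Edge T u v → isPair p q u v ≡ false → Edge T′ (fsuc u) (fsuc v)
  keep-edge uv ¬pq rewrite uv | ¬pq = refl

  parent′ : Fin (suc n) → Fin (suc n)
  parent′ fzero = fsuc p
  parent′ (fsuc v) with v ≟ q
  ... | yes _ = fzero
  ... | no _  = fsuc (parent v)

  descend′ : ∀ v → v ≡ fsuc root ⊎ (Edge T′ v (parent′ v) × rank′ (parent′ v) < rank′ v)
  descend′ fzero = inj₂ (⁅p⁆∨⁅q⁆-left p q , proj₁ p′<new<q′)
  descend′ (fsuc v) with v ≟ q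
  ... | yes refl = inj₂ (⁅p⁆∨⁅q⁆-right p q , proj₂ p′<new<q′)
  ... | no v≢q with descend v
  ...   | inj₁ refl         = inj₁ refl
  ...   | inj₂ (vu , u<v) = inj₂ (keep-edge vu (isPair-false p q v (parent v) not-pq (v≢q ∘ proj₁)) , *-monoʳ-< 2 u<v)
    where
    not-pq : ¬ (v ≡ p × parent v ≡ q)
    not-pq (refl , u≡q) = <-asym p<q (subst (λ x → rank x < rank p) u≡q u<v)

  adjacent′ : ∀ u v → Edge T′ u v → ¬ rank′ u ≡ rank′ v
  adjacent′ fzero    (fsuc v) _ = even≢odd (rank v) (rank p) ∘ sym
  adjacent′ (fsuc u) fzero    _ = even≢odd (rank u) (rank p)
  adjacent′ (fsuc u) (fsuc v) e = adjacent-rank≢ u v (proj₁ (old-edge e)) ∘ *-cancelˡ-≡ (rank u) (rank v) 2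

  below-new : ∀ u → Edge T′ fzero (fsuc u) → rank′ (fsuc u) < rank′ fzero → u ≡ p
  below-new u e u<new with ⁅p⁆∨⁅q⁆-true u e
  ... | inj₁ u≡p  = u≡p
  ... | inj₂ refl = ⊥-elim (<-asym u<new (proj₂ p′<new<q′))

  above-new : ∀ v → Edge T′ (fsuc v) fzero → rank′ fzero < rank′ (fsuc v) → v ≡ q
  above-new v e new<v with ⁅p⁆∨⁅q⁆-true v e
  ... | inj₁ refl = ⊥-elim (<-asym new<v (proj₁ p′<new<q′))
  ... | inj₂ v≡q  = v≡q

  new-and-old : ∀ v w → Edge T′ (fsuc v) fzero → Edge T′ (fsuc v) (fsuc w) →
                rank′ fzero < rank′ (fsuc v) → rank′ (fsuc w) < rank′ (fsuc v) → ⊥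
  new-and-old v w v↦new v↦w new<v w<v with above-new v v↦new new<v
  ... | refl with old-edge v↦w
  ...   | qw , ¬pair with lower-unique q w p qw (Edge-sym T pq) (*-cancelˡ-< 2 _ _ w<v) p<q
  ...     | refl = true≢false (trans (sym (isPair-swapped p q)) ¬pair)

  lower′ : ∀ v u w → Edge T′ v u → Edge T′ v w → rank′ u < rank′ v → rank′ w < rank′ v → u ≡ w
  lower′ fzero    (fsuc u) (fsuc w) vu vw u<v w<v = cong fsuc (trans (below-new u vu u<v) (sym (below-new w vw w<v)))
  lower′ (fsuc v) fzero    fzero    _  _  _   _   = refl
  lower′ (fsuc v) fzero    (fsuc w) vu vw u<v w<v = ⊥-elim (new-and-old v w vu vw u<v w<v)
  lower′ (fsuc v) (fsuc u) fzero    vu vw u<v w<v = ⊥-elim (new-and-old v u vw vu w<v u<v)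
  lower′ (fsuc v) (fsuc u) (fsuc w) vu vw u<v w<v = cong fsuc
    (lower-unique v u w (proj₁ (old-edge vu)) (proj₁ (old-edge vw)) (*-cancelˡ-< 2 _ _ u<v) (*-cancelˡ-< 2 _ _ w<v))

permute-ranked : ∀ {n} {T : Graph n} (π : Permutation′ n) → RankedTree T → RankedTree (permute π T)
permute-ranked {n} {T} π R = record
  { ranking        = record { rank = rank ∘ (π ⟨$⟩ʳ_) ; root = π ⟨$⟩ˡ root ; parent = parent′ ; descend = descend′ }
  ; adjacent-rank≢ = λ u v → adjacent-rank≢ (π ⟨$⟩ʳ u) (π ⟨$⟩ʳ v)
  ; lower-unique   = λ v u w vu vw u<v w<v → Injection.injective (↔⇒↣ π) (lower-unique _ _ _ vu vw u<v w<v) }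
  where
  open RankedTree R

  parent′ : Fin n → Fin n
  parent′ v = π ⟨$⟩ˡ parent (π ⟨$⟩ʳ v)

  descend′ : ∀ v → v ≡ π ⟨$⟩ˡ root ⊎ (Edge (permute π T) v (parent′ v) × rank (π ⟨$⟩ʳ parent′ v) < rank (π ⟨$⟩ʳ v))
  descend′ v with descend (π ⟨$⟩ʳ v)
  ... | inj₁ πv≡root = inj₁ (trans (sym (inverseˡ π)) (cong (π ⟨$⟩ˡ_) πv≡root))
  ... | inj₂ (up , lower) rewrite inverseʳ π {parent (π ⟨$⟩ʳ v)} = inj₂ (up , lower)

InducedC4-map : ∀ {n n′} {G : Graph n} {G′ : Graph n′} (f : Fin n → Fin n′) → (∀ {x y} → f x ≡ f y → x ≡ y) →
  ∀ {a b c d} → (∀ {u v} → OnC4 a b c d u → OnC4 a b c d v → adj G′ (f u) (f v) ≡ adj G u v) →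
  InducedC4 G a b c d → InducedC4 G′ (f a) (f b) (f c) (f d)
InducedC4-map f f-injective same (a≢b , a≢c , a≢d , b≢c , b≢d , c≢d , ab , bc , cd , da , ac , bd) =
  a≢b ∘ f-injective , a≢c ∘ f-injective , a≢d ∘ f-injective , b≢c ∘ f-injective , b≢d ∘ f-injective , c≢d ∘ f-injective ,
  trans (same a-on-C4 b-on-C4) ab , trans (same b-on-C4 c-on-C4) bc , trans (same c-on-C4 d-on-C4) cd ,
  trans (same d-on-C4 a-on-C4) da , trans (same a-on-C4 c-on-C4) ac , trans (same b-on-C4 d-on-C4) bd

-- Pivotal realizations

PrivateEdge : ∀ {n} → Graph n → Graph n → Fin n → Fin n → Set
PrivateEdge T₁ T₂ u w = (Edge T₁ u w × adj T₂ u w ≡ false) ⊎ (adj T₁ u w ≡ false × Edge T₂ u w)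

Subdividable : ∀ {n} → Graph n → Graph n → Fin n → Fin n → Fin n → Fin n → Fin n → Fin n → Set
Subdividable T₁ T₂ a b c d u w = ¬ (OnC4 a b c d u × OnC4 a b c d w) × PrivateEdge T₁ T₂ u w

-- The invariant of the induction: a C4-pivotable realization presented by its two trees, with edges
-- lying in exactly one tree and not joining two cycle vertices; subdividing such an edge keeps the
-- central cycle induced.
record Pivotal (N : ℕ) (degrees : Fin N → ℕ) : Set where
  field
    T₁ T₂     : Graph N
    ranked₁   : RankedTree T₁
    ranked₂   : RankedTree T₂
    a b c d   : Fin N
    central   : InducedC4 (T₁ ∪ T₂) a b c d
    ab-common : CommonEdge T₁ T₂ a b
    cd-common : CommonEdge T₁ T₂ c d
    common⊆   : ∀ u v → CommonEdge T₁ T₂ u v → SameEdge u v (a , b) ⊎ SameEdge u v (c , d)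
    realizes  : ∀ i → deg (T₁ ∪ T₂) i ≡ degrees i
    subdividable          : 5 ≤ N → Σ (Fin N) λ u → Σ (Fin N) λ w → Subdividable T₁ T₂ a b c d u w
    subdividable-avoiding : 6 ≤ N → ∀ s → Σ (Fin N) λ u → Σ (Fin N) λ w →
                            ¬ u ≡ s × ¬ w ≡ s × Subdividable T₁ T₂ a b c d u w

⊆-∪ˡ : ∀ {n} (G H : Graph n) u v → Edge G u v → Edge (G ∪ H) u v
⊆-∪ˡ G H u v uv rewrite uv = refl

⊆-∪ʳ : ∀ {n} (G H : Graph n) u v → Edge H u v → Edge (G ∪ H) u v
⊆-∪ʳ G H u v uv rewrite uv = ∨-zeroʳ (adj G u v)

edges-from-degree-sum : ∀ E n → E + E + 8 ≡ 4 * n → E + 4 ≡ 2 * n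
edges-from-degree-sum E n sum≡ = *-cancelˡ-≡ (E + 4) (2 * n) 2 (begin
  2 * (E + 4)    ≡⟨ regroup E ⟩
  E + E + 8      ≡⟨ sum≡ ⟩
  4 * n          ≡⟨ *-assoc 2 2 n ⟩
  2 * (2 * n)    ∎)
  where
  open ≡-Reasoning
  regroup : ∀ x → 2 * (x + 4) ≡ x + x + 8
  regroup = solve-∀

pivotal⇒pivotable-realization : ∀ {m} {degrees : Fin (suc m) → ℕ} → sum degrees + 8 ≡ 4 * suc m →
  Pivotal (suc m) degrees → Σ (Graph (suc m)) λ G → IsRealization G degrees × C4Pivotable G
pivotal⇒pivotable-realization {m} {degrees} degree-sum P =
  G , realization , (size , a , b , c , d , central , T₁ , T₂ ,
    (⊆-∪ˡ T₁ T₂ , rankedTree⇒tree ranked₁) , (⊆-∪ʳ T₁ T₂ , rankedTree⇒tree ranked₂) ,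
    (0F , 2F , (λ ()) , (λ { refl → ab-common }) , (λ { refl → cd-common }) , common⊆))
  where
  open Pivotal P
  G : Graph (suc m)
  G = T₁ ∪ T₂

  realization : IsRealization G degrees
  realization i = trans (degree≡deg G i) (realizes i)

  size : edgeCount G + 4 ≡ 2 * suc m
  size = edges-from-degree-sum (edgeCount G) (suc m)
    (trans (cong (_+ 8) (trans (handshake G) (sum-cong-≗ realizes))) degree-sum)

OnC4-map⁻¹ : ∀ {n n′} (f : Fin n → Fin n′) → (∀ {x y} → f x ≡ f y → x ≡ y) →
  ∀ {a b c d u} → OnC4 (f a) (f b) (f c) (f d) (f u) → OnC4 a b c d u
OnC4-map⁻¹ f f-injective (inj₁ eq)                 = inj₁ (f-injective eq)
OnC4-map⁻¹ f f-injective (inj₂ (inj₁ eq))          = inj₂ (inj₁ (f-injective eq))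
OnC4-map⁻¹ f f-injective (inj₂ (inj₂ (inj₁ eq)))   = inj₂ (inj₂ (inj₁ (f-injective eq)))
OnC4-map⁻¹ f f-injective (inj₂ (inj₂ (inj₂ eq)))   = inj₂ (inj₂ (inj₂ (f-injective eq)))

Subdividable-map : ∀ {n n′} {T₁ T₂ : Graph n} {T₁′ T₂′ : Graph n′} (f : Fin n → Fin n′) →
  (∀ {x y} → f x ≡ f y → x ≡ y) → ∀ {a b c d u w} →
  adj T₁′ (f u) (f w) ≡ adj T₁ u w → adj T₂′ (f u) (f w) ≡ adj T₂ u w →
  Subdividable T₁ T₂ a b c d u w → Subdividable T₁′ T₂′ (f a) (f b) (f c) (f d) (f u) (f w)
Subdividable-map {T₁ = T₁} {T₂} {T₁′} {T₂′} f f-injective {u = u} {w} same₁ same₂ (not-chord , private-edge) =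
  (λ (u∈C , w∈C) → not-chord (OnC4-map⁻¹ f f-injective u∈C , OnC4-map⁻¹ f f-injective w∈C)) ,
  transport private-edge
  where
  transport : PrivateEdge T₁ T₂ u w → PrivateEdge T₁′ T₂′ (f u) (f w)
  transport (inj₁ (in₁ , out₂)) = inj₁ (trans same₁ in₁ , trans same₂ out₂)
  transport (inj₂ (out₁ , in₂)) = inj₂ (trans same₁ out₁ , trans same₂ in₂)

swap-trees : ∀ {N degrees} → Pivotal N degrees → Pivotal N degrees
swap-trees P = record
  { T₁ = T₂ ; T₂ = T₁ ; ranked₁ = ranked₂ ; ranked₂ = ranked₁ ; a = a ; b = b ; c = c ; d = d
  ; central   = InducedC4-map {G = T₁ ∪ T₂} {G′ = T₂ ∪ T₁} (λ x → x) (λ eq → eq) (λ {u} {v} _ _ → ∪-comm u v) central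
  ; ab-common = ×-swap ab-common
  ; cd-common = ×-swap cd-common
  ; common⊆   = λ u v → common⊆ u v ∘ ×-swap
  ; realizes  = λ i → trans (sum-cong-≗ (λ j → cong b2n (∪-comm i j))) (realizes i)
  ; subdividable          = λ 5≤N → let u , w , s = subdividable 5≤N in u , w , swap-private s
  ; subdividable-avoiding = λ 6≤N s → let u , w , u≢s , w≢s , sub = subdividable-avoiding 6≤N s in
                                      u , w , u≢s , w≢s , swap-private sub }
  where
  open Pivotal P
  ∪-comm : ∀ i j → adj (T₂ ∪ T₁) i j ≡ adj (T₁ ∪ T₂) i j
  ∪-comm i j = ∨-comm (adj T₂ i j) (adj T₁ i j)
  swap-private : ∀ {u w} → Subdividable T₁ T₂ a b c d u w → Subdividable T₂ T₁ a b c d u w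
  swap-private (not-chord , inj₁ (in₁ , out₂)) = not-chord , inj₂ (out₂ , in₁)
  swap-private (not-chord , inj₂ (out₁ , in₂)) = not-chord , inj₁ (in₂ , out₁)

retarget : ∀ {N} {degrees degrees′ : Fin N → ℕ} → (∀ i → degrees i ≡ degrees′ i) → Pivotal N degrees → Pivotal N degrees′
retarget eq P = record { Pivotal P ; realizes = λ i → trans (Pivotal.realizes P i) (eq i) }

relabel : ∀ {N degrees} (π : Permutation′ N) → Pivotal N degrees → Pivotal N (degrees ∘ (π ⟨$⟩ʳ_))
relabel {N} π P = record
  { T₁ = permute π T₁ ; T₂ = permute π T₂
  ; ranked₁ = permute-ranked π ranked₁ ; ranked₂ = permute-ranked π ranked₂
  ; a = π⁻¹ a ; b = π⁻¹ b ; c = π⁻¹ c ; d = π⁻¹ d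
  ; central   = InducedC4-map {G = T₁ ∪ T₂} {G′ = permute π T₁ ∪ permute π T₂} π⁻¹ π⁻¹-injective
                              (λ {u} {v} _ _ → back (T₁ ∪ T₂) u v) central
  ; ab-common = back-edge T₁ (proj₁ ab-common) , back-edge T₂ (proj₂ ab-common)
  ; cd-common = back-edge T₁ (proj₁ cd-common) , back-edge T₂ (proj₂ cd-common)
  ; common⊆   = λ u v uv → Sum.map move move (common⊆ (π ⟨$⟩ʳ u) (π ⟨$⟩ʳ v) uv)
  ; realizes  = λ i → trans (sym (sum-permute (λ j → b2n (adj (T₁ ∪ T₂) (π ⟨$⟩ʳ i) j)) π)) (realizes (π ⟨$⟩ʳ i))
  ; subdividable          = λ 5≤N → let u , w , sub = subdividable 5≤N in π⁻¹ u , π⁻¹ w , move-subdividable sub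
  ; subdividable-avoiding = λ 6≤N s → let u , w , u≢s , w≢s , sub = subdividable-avoiding 6≤N (π ⟨$⟩ʳ s) in
      π⁻¹ u , π⁻¹ w , u≢s ∘ to-πˡ , w≢s ∘ to-πˡ , move-subdividable sub }
  where
  open Pivotal P

  π⁻¹ : Fin N → Fin N
  π⁻¹ = π ⟨$⟩ˡ_

  π⁻¹-injective : ∀ {x y} → π⁻¹ x ≡ π⁻¹ y → x ≡ y
  π⁻¹-injective = Injection.injective (↔⇒↣ (flip π))

  to-πˡ : ∀ {u s} → π⁻¹ u ≡ s → u ≡ π ⟨$⟩ʳ s
  to-πˡ {u} eq = trans (sym (inverseʳ π)) (cong (π ⟨$⟩ʳ_) eq)

  back : ∀ (G : Graph N) u v → adj (permute π G) (π⁻¹ u) (π⁻¹ v) ≡ adj G u v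
  back G u v = cong₂ (adj G) (inverseʳ π) (inverseʳ π)

  back-edge : ∀ (G : Graph N) {u v} → Edge G u v → Edge (permute π G) (π⁻¹ u) (π⁻¹ v)
  back-edge G {u} {v} uv = trans (back G u v) uv

  from-πʳ : ∀ {x y} → π ⟨$⟩ʳ x ≡ y → x ≡ π⁻¹ y
  from-πʳ eq = trans (sym (inverseˡ π)) (cong π⁻¹ eq)

  move : ∀ {u v p q} → SameEdge (π ⟨$⟩ʳ u) (π ⟨$⟩ʳ v) (p , q) → SameEdge u v (π⁻¹ p , π⁻¹ q)
  move (inj₁ (u≡p , v≡q)) = inj₁ (from-πʳ u≡p , from-πʳ v≡q)
  move (inj₂ (u≡q , v≡p)) = inj₂ (from-πʳ u≡q , from-πʳ v≡p)

  move-subdividable : ∀ {u w} → Subdividable T₁ T₂ a b c d u w →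
    Subdividable (permute π T₁) (permute π T₂) (π⁻¹ a) (π⁻¹ b) (π⁻¹ c) (π⁻¹ d) (π⁻¹ u) (π⁻¹ w)
  move-subdividable {u} {w} =
    Subdividable-map {T₁ = T₁} {T₂} {permute π T₁} {permute π T₂} π⁻¹ π⁻¹-injective (back T₁ u w) (back T₂ u w)

relabel⁻¹ : ∀ {N} {degrees : Fin N → ℕ} (π : Permutation′ N) → Pivotal N (degrees ∘ (π ⟨$⟩ʳ_)) → Pivotal N degrees
relabel⁻¹ {degrees = degrees} π P = retarget (λ i → cong degrees (inverseʳ π)) (relabel (flip π) P)

b2n-∨-disjoint : ∀ {x y} → (x ≡ true → y ≡ false) → b2n (x ∨ y) ≡ b2n x + b2n y
b2n-∨-disjoint {true}  {true}  x⇒¬y = ⊥-elim (true≢false (x⇒¬y refl))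
b2n-∨-disjoint {true}  {false} _    = refl
b2n-∨-disjoint {false}         _    = refl

b2n-⁅p⁆∨⁅q⁆ : ∀ {n} {p q : Fin n} → ¬ p ≡ q → ∀ j → b2n (⁅ p ⁆∨⁅ q ⁆ j) ≡ indicator p j + indicator q j
b2n-⁅p⁆∨⁅q⁆ {p = p} {q} p≢q j = b2n-∨-disjoint (λ j≟p → dec-false (j ≟ q) (p≢q ∘ trans (sym (≟-true⇒≡ j p j≟p))))

sum-⁅p⁆∨⁅q⁆ : ∀ {n} {p q : Fin n} → ¬ p ≡ q → sum (b2n ∘ ⁅ p ⁆∨⁅ q ⁆) ≡ 2
sum-⁅p⁆∨⁅q⁆ {p = p} {q} p≢q =
  trans (sum-cong-≗ (b2n-⁅p⁆∨⁅q⁆ p≢q)) (trans (∑-distrib-+ (indicator p) (indicator q)) (cong₂ _+_ (sum-indicator p) (sum-indicator q)))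

b2n-⁅p⁆∨⁅q⁆∨⁅r⁆ : ∀ {n} {p q r : Fin n} → ¬ p ≡ r → ¬ q ≡ r → ∀ j →
                  b2n (⁅ p ⁆∨⁅ q ⁆ j ∨ ⁅ r ⁆ j) ≡ b2n (⁅ p ⁆∨⁅ q ⁆ j) + indicator r j
b2n-⁅p⁆∨⁅q⁆∨⁅r⁆ {p = p} {q} {r} p≢r q≢r j = b2n-∨-disjoint j∈pq⇒j≢r
  where
  j∈pq⇒j≢r : ⁅ p ⁆∨⁅ q ⁆ j ≡ true → does (j ≟ r) ≡ false
  j∈pq⇒j≢r j∈pq with ⁅p⁆∨⁅q⁆-true j j∈pq
  ... | inj₁ refl = dec-false (j ≟ r) p≢r
  ... | inj₂ refl = dec-false (j ≟ r) q≢r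

sum-⁅p⁆∨⁅q⁆∨⁅r⁆ : ∀ {n} {p q r : Fin n} → ¬ p ≡ q → ¬ p ≡ r → ¬ q ≡ r → sum (λ j → b2n (⁅ p ⁆∨⁅ q ⁆ j ∨ ⁅ r ⁆ j)) ≡ 3
sum-⁅p⁆∨⁅q⁆∨⁅r⁆ {p = p} {q} {r} p≢q p≢r q≢r =
  trans (sum-cong-≗ (b2n-⁅p⁆∨⁅q⁆∨⁅r⁆ p≢r q≢r))
        (trans (∑-distrib-+ (b2n ∘ ⁅ p ⁆∨⁅ q ⁆) (indicator r)) (cong₂ _+_ (sum-⁅p⁆∨⁅q⁆ p≢q) (sum-indicator r)))

SameEdge-map : ∀ {n n′} (f : Fin n → Fin n′) {u v p q} → SameEdge u v (p , q) → SameEdge (f u) (f v) (f p , f q)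
SameEdge-map f (inj₁ (u≡p , v≡q)) = inj₁ (cong f u≡p , cong f v≡q)
SameEdge-map f (inj₂ (u≡q , v≡p)) = inj₂ (cong f u≡q , cong f v≡p)

new-vertex-subdividable : ∀ {n} {T₁ T₂ : Graph n} {nbr₁ nbr₂ : Fin n → Bool} {a b c d} x →
  PrivateEdge (extend T₁ nbr₁) (extend T₂ nbr₂) fzero (fsuc x) →
  Subdividable (extend T₁ nbr₁) (extend T₂ nbr₂) (fsuc a) (fsuc b) (fsuc c) (fsuc d) fzero (fsuc x)
new-vertex-subdividable _ private-edge = not-on-C4 ∘ proj₁ , private-edge
  where
  not-on-C4 : OnC4 _ _ _ _ fzero → ⊥
  not-on-C4 (inj₁ ())
  not-on-C4 (inj₂ (inj₁ ()))
  not-on-C4 (inj₂ (inj₂ (inj₁ ())))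
  not-on-C4 (inj₂ (inj₂ (inj₂ ())))

leafDegrees : ∀ {n} → Fin n → Fin n → (Fin n → ℕ) → Fin (suc n) → ℕ
leafDegrees p q degrees fzero    = 2
leafDegrees p q degrees (fsuc i) = b2n (⁅ p ⁆∨⁅ q ⁆ i) + degrees i

add-leaves : ∀ {n degrees} → Pivotal n degrees → ∀ {p q} → ¬ p ≡ q → Pivotal (suc n) (leafDegrees p q degrees)
add-leaves {n} P {p} {q} p≢q = record
  { T₁ = T₁′ ; T₂ = T₂′ ; ranked₁ = addLeaf-ranked ranked₁ p ; ranked₂ = addLeaf-ranked ranked₂ q
  ; a = fsuc a ; b = fsuc b ; c = fsuc c ; d = fsuc d
  ; central   = InducedC4-map {G = T₁ ∪ T₂} {G′ = T₁′ ∪ T₂′} fsuc suc-injective (λ _ _ → refl) central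
  ; ab-common = ab-common
  ; cd-common = cd-common
  ; common⊆   = common⊆′
  ; realizes  = λ { fzero → sum-⁅p⁆∨⁅q⁆ p≢q ; (fsuc i) → cong (b2n (⁅ p ⁆∨⁅ q ⁆ i) +_) (realizes i) }
  ; subdividable          = λ _ → fzero , fsuc p , new-edge p (inj₁ (at-p , at-p⇒¬q))
  ; subdividable-avoiding = avoiding }
  where
  open Pivotal P
  T₁′ T₂′ : Graph (suc n)
  T₁′ = extend T₁ ⁅ p ⁆
  T₂′ = extend T₂ ⁅ q ⁆

  new-edge : ∀ x → PrivateEdge T₁′ T₂′ fzero (fsuc x) → Subdividable T₁′ T₂′ (fsuc a) (fsuc b) (fsuc c) (fsuc d) fzero (fsuc x)
  new-edge = new-vertex-subdividable {T₁ = T₁} {T₂} {⁅ p ⁆} {⁅ q ⁆}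

  at-p : ⁅ p ⁆ p ≡ true
  at-p = dec-true (p ≟ p) refl

  at-p⇒¬q : ⁅ q ⁆ p ≡ false
  at-p⇒¬q = dec-false (p ≟ q) p≢q

  common⊆′ : ∀ u v → CommonEdge T₁′ T₂′ u v → SameEdge u v (fsuc a , fsuc b) ⊎ SameEdge u v (fsuc c , fsuc d)
  common⊆′ fzero    (fsuc j) (jp , jq) = ⊥-elim (p≢q (trans (sym (≟-true⇒≡ j p jp)) (≟-true⇒≡ j q jq)))
  common⊆′ (fsuc i) fzero    (ip , iq) = ⊥-elim (p≢q (trans (sym (≟-true⇒≡ i p ip)) (≟-true⇒≡ i q iq)))
  common⊆′ (fsuc i) (fsuc j) ij        = Sum.map (SameEdge-map fsuc) (SameEdge-map fsuc) (common⊆ i j ij)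

  avoiding : 6 ≤ suc n → ∀ s → Σ (Fin (suc n)) λ u → Σ (Fin (suc n)) λ w →
             ¬ u ≡ s × ¬ w ≡ s × Subdividable T₁′ T₂′ (fsuc a) (fsuc b) (fsuc c) (fsuc d) u w
  avoiding 6≤N fzero with subdividable (≤-pred 6≤N)
  ... | u , w , sub = fsuc u , fsuc w , (λ ()) , (λ ()) ,
                      Subdividable-map {T₁ = T₁} {T₂} {T₁′} {T₂′} fsuc suc-injective refl refl sub
  avoiding _ (fsuc s) with s ≟ p
  ... | yes refl = fzero , fsuc q , (λ ()) , p≢q ∘ sym ∘ suc-injective ,
                   new-edge q (inj₂ (dec-false (q ≟ s) (p≢q ∘ sym) , dec-true (q ≟ q) refl))
  ... | no s≢p   = fzero , fsuc p , (λ ()) , s≢p ∘ sym ∘ suc-injective , new-edge p (inj₁ (at-p , at-p⇒¬q))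

b2n-remove : ∀ {x y e} → (e ≡ true → x ≡ true × y ≡ false) → b2n ((x ∧ not e) ∨ y) + b2n e ≡ b2n (x ∨ y)
b2n-remove {x}    {y}     {false} _    = trans (+-identityʳ _) (cong (λ z → b2n (z ∨ y)) (∧-identityʳ x))
b2n-remove {true} {false} {true}  _    = refl
b2n-remove {false}        {e = true} e⇒ = ⊥-elim (true≢false (sym (proj₁ (e⇒ refl))))
b2n-remove {true} {true}  {true}  e⇒   = ⊥-elim (true≢false (proj₂ (e⇒ refl)))

sum-isPair : ∀ {n} {p q : Fin n} → ¬ p ≡ q → ∀ i → sum (λ j → b2n (isPair p q i j)) ≡ b2n (⁅ p ⁆∨⁅ q ⁆ i)
sum-isPair {n} {p} {q} p≢q i with i ≟ p | i ≟ q
... | yes refl | yes refl = ⊥-elim (p≢q refl)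
... | yes refl | no _     = trans (sum-cong-≗ (λ j → cong b2n (∨-identityʳ (does (j ≟ q))))) (sum-indicator q)
... | no _     | yes refl = sum-indicator p
... | no _     | no _     = sum-zero n

deg-subdivided : ∀ {n} (T₁ T₂ : Graph n) {p q r} → Edge T₁ p q → adj T₂ p q ≡ false → ¬ p ≡ q → ¬ p ≡ r → ¬ q ≡ r →
  ∀ i → deg (extend (deleteEdge T₁ p q) ⁅ p ⁆∨⁅ q ⁆ ∪ extend T₂ ⁅ r ⁆) (fsuc i) ≡ indicator r i + deg (T₁ ∪ T₂) i
deg-subdivided {n} T₁ T₂ {p} {q} {r} pq₁ pq∉T₂ p≢q p≢r q≢r i = begin
  b2n (⁅ p ⁆∨⁅ q ⁆ i ∨ ⁅ r ⁆ i) + sum kept            ≡⟨ cong (_+ sum kept) (b2n-⁅p⁆∨⁅q⁆∨⁅r⁆ p≢r q≢r i) ⟩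
  b2n (⁅ p ⁆∨⁅ q ⁆ i) + indicator r i + sum kept      ≡⟨ regroup (b2n (⁅ p ⁆∨⁅ q ⁆ i)) (indicator r i) (sum kept) ⟩
  indicator r i + (sum kept + b2n (⁅ p ⁆∨⁅ q ⁆ i))    ≡⟨ cong (λ x → indicator r i + (sum kept + x)) (sum-isPair p≢q i) ⟨
  indicator r i + (sum kept + sum removed)          ≡⟨ cong (indicator r i +_) (∑-distrib-+ kept removed) ⟨
  indicator r i + sum (λ j → kept j + removed j)    ≡⟨ cong (indicator r i +_) (sum-cong-≗ (λ j → b2n-remove (removed-edge j))) ⟩
  indicator r i + deg (T₁ ∪ T₂) i                   ∎
  where
  open ≡-Reasoning
  kept removed : Fin n → ℕ
  kept j    = b2n ((adj T₁ i j ∧ not (isPair p q i j)) ∨ adj T₂ i j)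
  removed j = b2n (isPair p q i j)
  removed-edge : ∀ j → isPair p q i j ≡ true → adj T₁ i j ≡ true × adj T₂ i j ≡ false
  removed-edge j ij with isPair-true p q i j ij
  ... | inj₁ (refl , refl) = pq₁ , pq∉T₂
  ... | inj₂ (refl , refl) = Edge-sym T₁ pq₁ , trans (Graph.sym T₂ q p) pq∉T₂
  regroup : ∀ x y z → x + y + z ≡ y + (z + x)
  regroup = solve-∀

subdivisionDegrees : ∀ {n} → Fin n → (Fin n → ℕ) → Fin (suc n) → ℕ
subdivisionDegrees r degrees fzero    = 3
subdivisionDegrees r degrees (fsuc i) = indicator r i + degrees i

subdivide : ∀ {n degrees} (P : Pivotal n degrees) → let open Pivotal P in 6 ≤ n → ∀ {p q r} →
  Edge T₁ p q → adj T₂ p q ≡ false → ¬ (OnC4 a b c d p × OnC4 a b c d q) →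
  RankedTree.rank ranked₁ p < RankedTree.rank ranked₁ q → ¬ p ≡ r → ¬ q ≡ r →
  Pivotal (suc n) (subdivisionDegrees r degrees)
subdivide {n} {degrees} P 6≤n {p} {q} {r} pq₁ pq∉T₂ not-chord p<q p≢r q≢r = record
  { T₁ = T₁′ ; T₂ = T₂′ ; ranked₁ = subdivide-ranked ranked₁ pq₁ p<q ; ranked₂ = addLeaf-ranked ranked₂ r
  ; a = fsuc a ; b = fsuc b ; c = fsuc c ; d = fsuc d
  ; central   = InducedC4-map {G = T₁ ∪ T₂} {G′ = T₁′ ∪ T₂′} fsuc suc-injective
                              (λ {u} {v} u∈C v∈C → cong (_∨ adj T₂ u v) (kept (off-pair u∈C v∈C))) central
  ; ab-common = trans (kept (off-pair a-on-C4 b-on-C4)) (proj₁ ab-common) , proj₂ ab-common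
  ; cd-common = trans (kept (off-pair c-on-C4 d-on-C4)) (proj₁ cd-common) , proj₂ cd-common
  ; common⊆   = common⊆′
  ; realizes  = realizes′
  ; subdividable          = λ _ → fzero , fsuc p , new-edge p (inj₁ (⁅p⁆∨⁅q⁆-left p q , dec-false (p ≟ r) p≢r))
  ; subdividable-avoiding = avoiding }
  where
  open Pivotal P
  T₁′ T₂′ : Graph (suc n)
  T₁′ = extend (deleteEdge T₁ p q) ⁅ p ⁆∨⁅ q ⁆
  T₂′ = extend T₂ ⁅ r ⁆

  p≢q : ¬ p ≡ q
  p≢q refl = <-irrefl refl p<q


  kept : ∀ {u v} → isPair p q u v ≡ false → adj T₁′ (fsuc u) (fsuc v) ≡ adj T₁ u v
  kept {u} {v} off rewrite off = ∧-identityʳ (adj T₁ u v)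

  off-pair : ∀ {u v} → OnC4 a b c d u → OnC4 a b c d v → isPair p q u v ≡ false
  off-pair {u} {v} u∈C v∈C = isPair-false p q u v (λ { (refl , refl) → not-chord (u∈C , v∈C) })
                                                  (λ { (refl , refl) → not-chord (v∈C , u∈C) })

  new-edge : ∀ x → PrivateEdge T₁′ T₂′ fzero (fsuc x) → Subdividable T₁′ T₂′ (fsuc a) (fsuc b) (fsuc c) (fsuc d) fzero (fsuc x)
  new-edge = new-vertex-subdividable {T₁ = deleteEdge T₁ p q} {T₂} {⁅ p ⁆∨⁅ q ⁆} {⁅ r ⁆}

  new-vertex-private : ∀ j → ⁅ p ⁆∨⁅ q ⁆ j ≡ true → ¬ j ≡ r
  new-vertex-private j j∈pq with ⁅p⁆∨⁅q⁆-true j j∈pq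
  ... | inj₁ refl = p≢r
  ... | inj₂ refl = q≢r

  common⊆′ : ∀ u v → CommonEdge T₁′ T₂′ u v → SameEdge u v (fsuc a , fsuc b) ⊎ SameEdge u v (fsuc c , fsuc d)
  common⊆′ fzero    (fsuc j) (j∈pq , j≟r) = ⊥-elim (new-vertex-private j j∈pq (≟-true⇒≡ j r j≟r))
  common⊆′ (fsuc i) fzero    (i∈pq , i≟r) = ⊥-elim (new-vertex-private i i∈pq (≟-true⇒≡ i r i≟r))
  common⊆′ (fsuc i) (fsuc j) (ij₁ , ij₂)  =
    Sum.map (SameEdge-map fsuc) (SameEdge-map fsuc) (common⊆ i j (∧-conicalˡ _ _ ij₁ , ij₂))

  realizes′ : ∀ i → deg (T₁′ ∪ T₂′) i ≡ subdivisionDegrees r degrees i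
  realizes′ fzero    = sum-⁅p⁆∨⁅q⁆∨⁅r⁆ p≢q p≢r q≢r
  realizes′ (fsuc i) = trans (deg-subdivided T₁ T₂ pq₁ pq∉T₂ p≢q p≢r q≢r i) (cong (indicator r i +_) (realizes i))

  avoiding : 6 ≤ suc n → ∀ s → Σ (Fin (suc n)) λ u → Σ (Fin (suc n)) λ w →
             ¬ u ≡ s × ¬ w ≡ s × Subdividable T₁′ T₂′ (fsuc a) (fsuc b) (fsuc c) (fsuc d) u w
  avoiding _ fzero with subdividable-avoiding 6≤n p
  ... | u , w , u≢p , w≢p , sub = fsuc u , fsuc w , (λ ()) , (λ ()) ,
    Subdividable-map {T₁ = T₁} {T₂} {T₁′} {T₂′} fsuc suc-injective
      (kept (isPair-false p q u w (u≢p ∘ proj₁) (w≢p ∘ proj₂))) refl sub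
  avoiding _ (fsuc s) with s ≟ p
  ... | yes refl = fzero , fsuc q , (λ ()) , p≢q ∘ sym ∘ suc-injective ,
                   new-edge q (inj₁ (⁅p⁆∨⁅q⁆-right s q , dec-false (q ≟ r) q≢r))
  ... | no s≢p   = fzero , fsuc p , (λ ()) , s≢p ∘ sym ∘ suc-injective ,
                   new-edge p (inj₁ (⁅p⁆∨⁅q⁆-left p q , dec-false (p ≟ r) p≢r))

subdivide-private : ∀ {n degrees} (P : Pivotal n degrees) → let open Pivotal P in 6 ≤ n → ∀ {u w r} →
  Edge T₁ u w → adj T₂ u w ≡ false → ¬ (OnC4 a b c d u × OnC4 a b c d w) → ¬ u ≡ r → ¬ w ≡ r →
  Pivotal (suc n) (subdivisionDegrees r degrees)
subdivide-private P 6≤n {u} {w} uw₁ uw∉T₂ not-chord u≢r w≢r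
  with ℕ.<-cmp (RankedTree.rank (Pivotal.ranked₁ P) u) (RankedTree.rank (Pivotal.ranked₁ P) w)
... | tri< u<w _ _ = subdivide P 6≤n uw₁ uw∉T₂ not-chord u<w u≢r w≢r
... | tri≈ _ u≈w _ = ⊥-elim (RankedTree.adjacent-rank≢ (Pivotal.ranked₁ P) u w uw₁ u≈w)
... | tri> _ _ w<u = subdivide P 6≤n (Edge-sym (Pivotal.T₁ P) uw₁) (trans (Graph.sym (Pivotal.T₂ P) w u) uw∉T₂)
                               (not-chord ∘ ×-swap) w<u w≢r u≢r

subdivide-avoiding : ∀ {n degrees} → Pivotal n degrees → 6 ≤ n → ∀ r → Pivotal (suc n) (subdivisionDegrees r degrees)
subdivide-avoiding P 6≤n r with Pivotal.subdividable-avoiding P 6≤n r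
... | _ , _ , u≢r , w≢r , not-chord , inj₁ (uw₁ , uw∉T₂) = subdivide-private P 6≤n uw₁ uw∉T₂ not-chord u≢r w≢r
... | _ , _ , u≢r , w≢r , not-chord , inj₂ (uw∉T₁ , uw₂) = subdivide-private (swap-trees P) 6≤n uw₂ uw∉T₁ not-chord u≢r w≢r

-- Sufficiency of the degree conditions

decidedGraph : ∀ {n} (e : Fin n → Fin n → Bool) →
  {True (all? (λ i → all? (λ j → e i j Bool.≟ e j i)) ×-dec all? (λ i → e i i Bool.≟ false))} → Graph n
decidedGraph e {proofs} = record { adj = e ; sym = proj₁ (toWitness proofs) ; irrefl = proj₂ (toWitness proofs) }

module _ {n} (T : Graph n) (rank : Fin n → ℕ) (root : Fin n) (parent : Fin n → Fin n) where
  private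
    Edge? : ∀ u v → Dec (Edge T u v)
    Edge? u v = adj T u v Bool.≟ true

  decidedRankedTree :
    {True (all? (λ v → (v ≟ root) ⊎-dec (Edge? v (parent v) ×-dec rank (parent v) ℕ.<? rank v)) ×-dec
           all? (λ u → all? (λ v → Edge? u v →-dec ¬? (rank u ℕ.≟ rank v))) ×-dec
           all? (λ v → all? (λ u → all? (λ w → Edge? v u →-dec Edge? v w →-dec rank u ℕ.<? rank v →-dec
                                                rank w ℕ.<? rank v →-dec u ≟ w))))} →
    RankedTree T
  decidedRankedTree {proofs} = record
    { ranking        = record { rank = rank ; root = root ; parent = parent ; descend = proj₁ (toWitness proofs) }
    ; adjacent-rank≢ = proj₁ (proj₂ (toWitness proofs))
    ; lower-unique   = proj₂ (proj₂ (toWitness proofs)) }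

-- T₁ is the path 0-1-2-3 and T₂ the path 1-0-3-2: their union is the 4-cycle, with common edges 01, 23.
private
  path₁ path₂ : Fin 4 → Fin 4 → Bool
  path₁ 0F 1F = true
  path₁ 1F 0F = true
  path₁ 1F 2F = true
  path₁ 2F 1F = true
  path₁ 2F 3F = true
  path₁ 3F 2F = true
  path₁ _  _  = false
  path₂ 0F 1F = true
  path₂ 1F 0F = true
  path₂ 0F 3F = true
  path₂ 3F 0F = true
  path₂ 2F 3F = true
  path₂ 3F 2F = true
  path₂ _  _  = false

  T₁⁰ T₂⁰ : Graph 4
  T₁⁰ = decidedGraph path₁
  T₂⁰ = decidedGraph path₂

  parent₁ parent₂ : Fin 4 → Fin 4
  parent₁ 0F = 0F
  parent₁ 1F = 0F
  parent₁ 2F = 1F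
  parent₁ 3F = 2F
  parent₂ 0F = 1F
  parent₂ 1F = 1F
  parent₂ 2F = 3F
  parent₂ 3F = 0F

  rank₂ : Fin 4 → ℕ
  rank₂ 0F = 1
  rank₂ 1F = 0
  rank₂ 2F = 3
  rank₂ 3F = 2

  sameEdge? : ∀ {n} (u v : Fin n) e → Dec (SameEdge u v e)
  sameEdge? u v (p , q) = (u ≟ p ×-dec v ≟ q) ⊎-dec (u ≟ q ×-dec v ≟ p)

  5≰4 : ¬ 5 ≤ 4
  5≰4 (s≤s (s≤s (s≤s (s≤s ()))))

pivotal-C4 : Pivotal 4 (const 2)
pivotal-C4 = record
  { T₁ = T₁⁰ ; T₂ = T₂⁰
  ; ranked₁ = decidedRankedTree T₁⁰ toℕ 0F parent₁
  ; ranked₂ = decidedRankedTree T₂⁰ rank₂ 1F parent₂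
  ; a = 0F ; b = 1F ; c = 2F ; d = 3F
  ; central   = (λ ()) , (λ ()) , (λ ()) , (λ ()) , (λ ()) , (λ ()) , refl , refl , refl , refl , refl , refl
  ; ab-common = refl , refl
  ; cd-common = refl , refl
  ; common⊆   = from-yes (all? λ u → all? λ v → (adj T₁⁰ u v Bool.≟ true ×-dec adj T₂⁰ u v Bool.≟ true) →-dec
                                                 (sameEdge? u v (0F , 1F) ⊎-dec sameEdge? u v (2F , 3F)))
  ; realizes  = from-yes (all? λ i → deg (T₁⁰ ∪ T₂⁰) i ℕ.≟ 2)
  ; subdividable          = ⊥-elim ∘ 5≰4
  ; subdividable-avoiding = λ 6≤4 → ⊥-elim (5≰4 (≤-trans (n≤1+n 5) 6≤4)) }

DegreeConditions : ∀ N → (Fin N → ℕ) → Set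
DegreeConditions N degrees = (sum degrees + 8 ≡ 4 * N) × (∀ i → 2 ≤ degrees i) × (∀ i → degrees i + 2 ≤ N)

private
  absurd-≤ : ∀ {x y} z → x ≡ y + suc z → x ≤ y → ⊥
  absurd-≤ {y = y} z eq x≤y = m+1+n≰m y (subst (_≤ y) eq x≤y)

  reduced-sum : ∀ n {s′ s e c} → s′ + c ≡ s → e + c ≡ 4 → e + s + 8 ≡ 4 * suc n → s′ + 8 ≡ 4 * n
  reduced-sum n {s′} {s} {e} {c} s′+c≡s e+c≡4 sum≡ = +-cancelʳ-≡ 4 (s′ + 8) (4 * n) (begin
    s′ + 8 + 4              ≡⟨ cong (s′ + 8 +_) e+c≡4 ⟨
    s′ + 8 + (e + c)        ≡⟨ regroup s′ e c ⟩
    e + (s′ + c) + 8        ≡⟨ cong (λ x → e + x + 8) s′+c≡s ⟩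
    e + s + 8               ≡⟨ sum≡ ⟩
    4 * suc n               ≡⟨ *-suc 4 n ⟩
    4 + 4 * n               ≡⟨ +-comm 4 (4 * n) ⟩
    4 * n + 4               ∎)
    where
    open ≡-Reasoning
    regroup : ∀ x y z → x + 8 + (y + z) ≡ y + (x + z) + 8
    regroup = solve-∀

  -- The arithmetic of the inductive step: n = 4 + k vertices remain after removing a vertex of degree
  -- 2 or 3, and s is the sum of their degrees.
  largest-≥3 : ∀ k s → s ≤ (4 + k) * 2 → 2 + s + 8 ≡ 4 * (5 + k) → ⊥
  largest-≥3 k s s≤ sum≡ = absurd-≤ (1 + 2 * k) (identity k) (begin
    4 * (5 + k)          ≡⟨ sum≡ ⟨
    2 + s + 8            ≤⟨ +-monoˡ-≤ 8 (+-monoʳ-≤ 2 s≤) ⟩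
    2 + (4 + k) * 2 + 8  ∎)
    where
    open ≤-Reasoning
    identity : ∀ k → 4 * (5 + k) ≡ 2 + (4 + k) * 2 + 8 + suc (1 + 2 * k)
    identity = solve-∀

  second-≥3 : ∀ k s t → s + 2 ≤ (4 + k) * 2 + t → t + 2 ≤ 5 + k → 2 + s + 8 ≡ 4 * (5 + k) → ⊥
  second-≥3 k s t s≤ t≤ sum≡ = absurd-≤ k (identity k) (begin
    4 * (5 + k) + 4             ≡⟨ cong (_+ 4) sum≡ ⟨
    2 + s + 8 + 4               ≡⟨ regroup s ⟩
    s + 2 + 12                  ≤⟨ +-monoˡ-≤ 12 s≤ ⟩
    (4 + k) * 2 + t + 12        ≡⟨ regroup′ ((4 + k) * 2) t ⟩
    (4 + k) * 2 + 10 + (t + 2)  ≤⟨ +-monoʳ-≤ ((4 + k) * 2 + 10) t≤ ⟩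
    (4 + k) * 2 + 10 + (5 + k)  ∎)
    where
    open ≤-Reasoning
    identity : ∀ k → 4 * (5 + k) + 4 ≡ (4 + k) * 2 + 10 + (5 + k) + suc k
    identity = solve-∀
    regroup : ∀ x → 2 + x + 8 + 4 ≡ x + 2 + 12
    regroup = solve-∀
    regroup′ : ∀ x y → x + y + 12 ≡ x + 10 + (y + 2)
    regroup′ = solve-∀

  others-≤ : ∀ k s t₁ t₂ t₃ → (4 + k) * 2 + (t₁ + t₂ + t₃) ≤ s + 3 * 2 → t₃ ≤ t₁ → t₃ ≤ t₂ → 5 + k ≤ t₃ + 2 →
             2 + s + 8 ≡ 4 * (5 + k) → ⊥
  others-≤ k s t₁ t₂ t₃ triple t₃≤t₁ t₃≤t₂ large sum≡ = absurd-≤ k (identity k) (begin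
    (4 + k) * 2 + ((5 + k) + (5 + k) + (5 + k))         ≤⟨ +-monoʳ-≤ ((4 + k) * 2) (+-mono-≤ (+-mono-≤ (up t₃≤t₁) (up t₃≤t₂)) large) ⟩
    (4 + k) * 2 + ((t₁ + 2) + (t₂ + 2) + (t₃ + 2))      ≡⟨ regroup ((4 + k) * 2) t₁ t₂ t₃ ⟩
    (4 + k) * 2 + (t₁ + t₂ + t₃) + 6                    ≤⟨ +-monoˡ-≤ 6 triple ⟩
    s + 6 + 6                                           ≡⟨ regroup′ s ⟩
    2 + s + 8 + 2                                       ≡⟨ cong (_+ 2) sum≡ ⟩
    4 * (5 + k) + 2                                     ∎)
    where
    open ≤-Reasoning
    up : ∀ {t} → t₃ ≤ t → 5 + k ≤ t + 2
    up t₃≤t = ≤-trans large (+-monoˡ-≤ 2 t₃≤t)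
    identity : ∀ k → (4 + k) * 2 + ((5 + k) + (5 + k) + (5 + k)) ≡ 4 * (5 + k) + 2 + suc k
    identity = solve-∀
    regroup : ∀ x a b c → x + ((a + 2) + (b + 2) + (c + 2)) ≡ x + (a + b + c) + 6
    regroup = solve-∀
    regroup′ : ∀ x → x + 6 + 6 ≡ 2 + x + 8 + 2
    regroup′ = solve-∀

  at-least-7 : ∀ n s → n * 3 ≤ s → 3 + s + 8 ≡ 4 * suc n → 7 ≤ n
  at-least-7 n s s≥ sum≡ = +-cancelˡ-≤ (n * 3 + 4) 7 n (begin
    n * 3 + 4 + 7        ≡⟨ +-assoc (n * 3) 4 7 ⟩
    n * 3 + 11           ≤⟨ +-monoˡ-≤ 11 s≥ ⟩
    s + 11               ≡⟨ regroup s ⟩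
    3 + s + 8            ≡⟨ sum≡ ⟩
    4 * suc n            ≡⟨ identity n ⟩
    n * 3 + 4 + n        ∎)
    where
    open ≤-Reasoning
    regroup : ∀ x → x + 11 ≡ 3 + x + 8
    regroup = solve-∀
    identity : ∀ n → 4 * suc n ≡ n * 3 + 4 + n
    identity = solve-∀

  below-by-4 : ∀ n s t → n * 3 + t ≤ s + 3 → 3 + s + 8 ≡ 4 * suc n → t + 4 ≤ n
  below-by-4 n s t point sum≡ = +-cancelˡ-≤ (n * 3 + 4) (t + 4) n (begin
    n * 3 + 4 + (t + 4)  ≡⟨ regroup (n * 3) t ⟩
    n * 3 + t + 8        ≤⟨ +-monoˡ-≤ 8 point ⟩
    s + 3 + 8            ≡⟨ cong (_+ 8) (+-comm s 3) ⟩
    3 + s + 8            ≡⟨ sum≡ ⟩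
    4 * suc n            ≡⟨ identity n ⟩
    n * 3 + 4 + n        ∎)
    where
    open ≤-Reasoning
    regroup : ∀ x y → x + 4 + (y + 4) ≡ x + y + 8
    regroup = solve-∀
    identity : ∀ n → 4 * suc n ≡ n * 3 + 4 + n
    identity = solve-∀

  all-≥4 : ∀ N s → N * 4 ≤ s → s + 8 ≡ 4 * N → ⊥
  all-≥4 N s s≥ sum≡ = absurd-≤ 7 (identity N) (begin
    N * 4 + 8  ≤⟨ +-monoˡ-≤ 8 s≥ ⟩
    s + 8      ≡⟨ sum≡ ⟩
    4 * N      ∎)
    where
    open ≤-Reasoning
    identity : ∀ N → N * 4 + 8 ≡ 4 * N + suc 7
    identity = solve-∀

  at-least-4 : ∀ N s → N * 2 ≤ s → s + 8 ≡ 4 * N → 4 ≤ N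
  at-least-4 N s s≥ sum≡ = *-cancelˡ-≤ 2 (+-cancelˡ-≤ (N * 2) (2 * 4) (2 * N) (begin
    N * 2 + 8      ≤⟨ +-monoˡ-≤ 8 s≥ ⟩
    s + 8          ≡⟨ sum≡ ⟩
    4 * N          ≡⟨ identity N ⟩
    N * 2 + 2 * N  ∎))
    where
    open ≤-Reasoning
    identity : ∀ N → 4 * N ≡ N * 2 + 2 * N
    identity = solve-∀

  pred+2≤ : ∀ {x n} → 1 ≤ x → x + 2 ≤ suc n → x ∸ 1 + 2 ≤ n
  pred+2≤ {suc x} _ x+2≤ = ≤-pred x+2≤

  another : ∀ {m} (p : Fin (suc (suc m))) → Σ (Fin (suc (suc m))) λ j → ¬ j ≡ p
  another fzero    = 1F , λ ()
  another (fsuc p) = 0F , λ ()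

module _ (k : ℕ) (degrees : Fin (5 + k) → ℕ) (conditions : DegreeConditions (5 + k) degrees)
         (induction : ∀ degrees′ → DegreeConditions (4 + k) degrees′ → Pivotal (4 + k) degrees′) where
  private
    n : ℕ
    n = 4 + k

    degree-sum : sum degrees + 8 ≡ 4 * suc n
    degree-sum = proj₁ conditions

    lower : ∀ i → 2 ≤ degrees i
    lower = proj₁ (proj₂ conditions)

    upper : ∀ i → degrees i + 2 ≤ suc n
    upper = proj₂ (proj₂ conditions)

    module Removing (x : Fin (suc n)) where
      π : Permutation′ (suc n)
      π = transpose 0F x

      rest : Fin n → ℕ
      rest j = degrees (π ⟨$⟩ʳ fsuc j)

      rest-sum : degrees x + sum rest + 8 ≡ 4 * suc n
      rest-sum = trans (cong (_+ 8) (sym (sum-permute degrees π))) degree-sum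

      rest-lower : ∀ j → 2 ≤ rest j
      rest-lower j = lower (π ⟨$⟩ʳ fsuc j)

      rest-upper : ∀ j → rest j + 2 ≤ suc n
      rest-upper j = upper (π ⟨$⟩ʳ fsuc j)

    -- p carries the largest remaining degree and q the largest one once p is set aside.
    module RemovingDegreeTwo (x : Fin (suc n)) (x-deg : degrees x ≡ 2)
      (p : Fin n) (below-p : ∀ j → Removing.rest x j ≤ Removing.rest x p)
      (q : Fin n) (below-q′ : ∀ j → updateAt (Removing.rest x) p (const 0) j ≤ updateAt (Removing.rest x) p (const 0) q)
      where
      open Removing x

      rest-sum′ : 2 + sum rest + 8 ≡ 4 * suc n
      rest-sum′ = subst (λ e → e + sum rest + 8 ≡ 4 * suc n) x-deg rest-sum

      rest′ : Fin n → ℕ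
      rest′ = updateAt rest p (const 0)

      rest′≡rest : ∀ j → ¬ j ≡ p → rest′ j ≡ rest j
      rest′≡rest j j≢p = updateAt-minimal j p rest j≢p

      below-q : ∀ j → ¬ j ≡ p → rest j ≤ rest′ q
      below-q j j≢p = subst (_≤ rest′ q) (rest′≡rest j j≢p) (below-q′ j)

      p≢q : ¬ p ≡ q
      p≢q p≡q with another p
      ... | j , j≢p = contradiction (begin
        2        ≤⟨ rest-lower j ⟩
        rest j   ≤⟨ below-q j j≢p ⟩
        rest′ q  ≡⟨ cong rest′ p≡q ⟨
        rest′ p  ≡⟨ updateAt-updates p rest ⟩
        0        ∎) λ ()
        where open ≤-Reasoning

      rest′-q : rest′ q ≡ rest q
      rest′-q = rest′≡rest q (p≢q ∘ sym)

      p-≥3 : 3 ≤ rest p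
      p-≥3 with 3 ≤? rest p
      ... | yes 3≤p = 3≤p
      ... | no 3≰p  = ⊥-elim (largest-≥3 k (sum rest) (sum-≤-const 2 (λ j → ≤-trans (below-p j) (≤-pred (≰⇒> 3≰p)))) rest-sum′)

      q-≥3 : 3 ≤ rest q
      q-≥3 with 3 ≤? rest q
      ... | yes 3≤q = 3≤q
      ... | no 3≰q  = ⊥-elim (second-≥3 k (sum rest) (rest p) (sum-≤-point rest 2 p small) (rest-upper p) rest-sum′)
        where
        small : ∀ j → ¬ j ≡ p → rest j ≤ 2
        small j j≢p = ≤-trans (below-q j j≢p) (subst (_≤ 2) (sym rest′-q) (≤-pred (≰⇒> 3≰q)))

      others-upper : ∀ j → ¬ j ≡ p → ¬ j ≡ q → rest j + 2 ≤ n
      others-upper j j≢p j≢q with rest j + 2 ≤? n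
      ... | yes fits = fits
      ... | no  large = ⊥-elim (others-≤ k (sum rest) (rest p) (rest q) (rest j)
              (sum-≥-triple rest 2 rest-lower p≢q (j≢p ∘ sym) (j≢q ∘ sym)) (below-p j)
              (subst (rest j ≤_) rest′-q (below-q j j≢p)) (≰⇒> large) rest-sum′)

      stub : Fin n → ℕ
      stub j = b2n (⁅ p ⁆∨⁅ q ⁆ j)

      stub≤rest : ∀ j → stub j ≤ rest j
      stub≤rest j = ≤-trans (b2n≤1 _) (≤-trans (n≤1+n 1) (rest-lower j))

      reduced : Fin n → ℕ
      reduced j = rest j ∸ stub j

      reduced-conditions : DegreeConditions n reduced
      reduced-conditions = reduced-sum n {e = 2} sum-reduced refl rest-sum′ , reduced-lower , reduced-upper
        where
        sum-reduced : sum reduced + 2 ≡ sum rest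
        sum-reduced = trans (cong (sum reduced +_) (sym (sum-⁅p⁆∨⁅q⁆ p≢q))) (sum-∸ rest stub stub≤rest)
        reduced-lower : ∀ j → 2 ≤ reduced j
        reduced-lower j with j ≟ p | j ≟ q
        ... | yes refl | _        = ∸-monoˡ-≤ 1 p-≥3
        ... | no _     | yes refl = ∸-monoˡ-≤ 1 q-≥3
        ... | no _     | no _     = rest-lower j
        reduced-upper : ∀ j → reduced j + 2 ≤ n
        reduced-upper j with j ≟ p | j ≟ q
        ... | yes refl | _        = pred+2≤ (≤-trans (s≤s z≤n) p-≥3) (rest-upper j)
        ... | no _     | yes refl = pred+2≤ (≤-trans (s≤s z≤n) q-≥3) (rest-upper j)
        ... | no j≢p   | no j≢q   = others-upper j j≢p j≢q

      result : Pivotal (suc n) degrees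
      result = relabel⁻¹ π (retarget matches (add-leaves (induction reduced reduced-conditions) p≢q))
        where
        matches : ∀ i → leafDegrees p q reduced i ≡ degrees (π ⟨$⟩ʳ i)
        matches fzero    = sym x-deg
        matches (fsuc j) = m+[n∸m]≡n (stub≤rest j)

    module RemovingDegreeThree (x : Fin (suc n)) (x-deg : degrees x ≡ 3) (no-two : ∀ i → ¬ degrees i ≡ 2) where
      open Removing x

      rest-sum′ : 3 + sum rest + 8 ≡ 4 * suc n
      rest-sum′ = subst (λ e → e + sum rest + 8 ≡ 4 * suc n) x-deg rest-sum

      rest-≥3 : ∀ j → 3 ≤ rest j
      rest-≥3 j = ≤∧≢⇒< (rest-lower j) (no-two _ ∘ sym)

      6≤n : 6 ≤ n
      6≤n = ≤-trans (n≤1+n 6) (at-least-7 n (sum rest) (sum-≥-const 3 rest-≥3) rest-sum′)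

      r : Fin n
      r = 0F

      indicator≤rest : ∀ j → indicator r j ≤ rest j
      indicator≤rest j = ≤-trans (b2n≤1 _) (≤-trans (s≤s z≤n) (rest-≥3 j))

      reduced : Fin n → ℕ
      reduced j = rest j ∸ indicator r j

      reduced-conditions : DegreeConditions n reduced
      reduced-conditions = reduced-sum n {e = 3} sum-reduced refl rest-sum′ , reduced-lower , reduced-upper
        where
        sum-reduced : sum reduced + 1 ≡ sum rest
        sum-reduced = trans (cong (sum reduced +_) (sym (sum-indicator r))) (sum-∸ rest (indicator r) indicator≤rest)
        reduced-lower : ∀ j → 2 ≤ reduced j
        reduced-lower j = ≤-trans (∸-monoˡ-≤ 1 (rest-≥3 j)) (∸-monoʳ-≤ (rest j) (b2n≤1 (does (j ≟ r))))
        reduced-upper : ∀ j → reduced j + 2 ≤ n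
        reduced-upper j = ≤-trans (+-mono-≤ (m∸n≤m (rest j) (indicator r j)) (s≤s (s≤s z≤n)))
                                  (below-by-4 n (sum rest) (rest j) (sum-≥-point rest 3 rest-≥3 j) rest-sum′)

      result : Pivotal (suc n) degrees
      result = relabel⁻¹ π (retarget matches (subdivide-avoiding (induction reduced reduced-conditions) 6≤n r))
        where
        matches : ∀ i → subdivisionDegrees r reduced i ≡ degrees (π ⟨$⟩ʳ i)
        matches fzero    = sym x-deg
        matches (fsuc j) = m+[n∸m]≡n (indicator≤rest j)

  pivotal-step : Pivotal (5 + k) degrees
  pivotal-step with any? (λ i → degrees i ℕ.≟ 2)
  ... | yes (x , x-deg) = RemovingDegreeTwo.result x x-deg p (proj₂ (argmax rest)) _ (proj₂ (argmax (updateAt rest p (const 0))))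
    where
    open Removing x using (rest)
    p : Fin (4 + k)
    p = proj₁ (argmax rest)
  ... | no no-two with any? (λ i → degrees i ℕ.≟ 3)
  ...   | yes (x , x-deg) = RemovingDegreeThree.result x x-deg (λ i eq → no-two (i , eq))
  ...   | no no-three     = ⊥-elim (all-≥4 (5 + k) (sum degrees) (sum-≥-const 4 at-least-4′) degree-sum)
    where
    at-least-4′ : ∀ i → 4 ≤ degrees i
    at-least-4′ i = ≤∧≢⇒< (≤∧≢⇒< (lower i) (λ eq → no-two (i , sym eq))) (λ eq → no-three (i , sym eq))

at-least-four-vertices : ∀ {N} {degrees : Fin N → ℕ} → DegreeConditions N degrees → 4 ≤ N
at-least-four-vertices {N} {degrees} (sum≡ , lower , _) = at-least-4 N (sum degrees) (sum-≥-const 2 lower) sum≡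

conditions⇒pivotal : ∀ n degrees → DegreeConditions (suc n) degrees → Pivotal (suc n) degrees
conditions⇒pivotal 0 _ conditions with at-least-four-vertices conditions
... | s≤s ()
conditions⇒pivotal 1 _ conditions with at-least-four-vertices conditions
... | s≤s (s≤s ())
conditions⇒pivotal 2 _ conditions with at-least-four-vertices conditions
... | s≤s (s≤s (s≤s ()))
conditions⇒pivotal 3 degrees (sum≡ , lower , _) =
  retarget (λ i → sym (sum-≤-const⇒≡ 2 lower (≤-reflexive (+-cancelʳ-≡ 8 (sum degrees) 8 sum≡)) i)) pivotal-C4
conditions⇒pivotal (suc (suc (suc (suc k)))) degrees conditions =
  pivotal-step k degrees conditions (conditions⇒pivotal (suc (suc (suc k))))

pivotable-realization⇒conditions : ∀ m (d : Fin (suc m) → ℕ) (G : Graph (suc m)) → IsRealization G d → C4Pivotable G →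
  (ΣFin (suc m) d + 4 ≡ 4 * m) × d fzero < m × 2 ≤ d (fromℕ m)
pivotable-realization⇒conditions m d G realizes pivotable with pivotable⇒degree-conditions G pivotable
... | degree-sum , below-m , at-least-2 =
  trans (cong (_+ 4) (trans (ΣFin≡sum (suc m) d) (sum-cong-≗ (sym ∘ deg≡d)))) degree-sum ,
  subst (_< m) (deg≡d fzero) (below-m fzero) ,
  subst (2 ≤_) (deg≡d (fromℕ m)) (at-least-2 (fromℕ m))
  where
  deg≡d : ∀ v → deg G v ≡ d v
  deg≡d v = trans (sym (degree≡deg G v)) (realizes v)

conditions⇒degree-conditions : ∀ m (d : Fin (suc m) → ℕ) → NonIncreasing d →
  (ΣFin (suc m) d + 4 ≡ 4 * m) × d fzero < m × 2 ≤ d (fromℕ m) → DegreeConditions (suc m) d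
conditions⇒degree-conditions m d non-increasing (sum≡ , d₁<m , 2≤dₙ) = degree-sum , lower , upper
  where
  degree-sum : sum d + 8 ≡ 4 * suc m
  degree-sum = begin
    sum d + 8          ≡⟨ +-assoc (sum d) 4 4 ⟨
    sum d + 4 + 4      ≡⟨ cong (λ s → s + 4 + 4) (ΣFin≡sum (suc m) d) ⟨
    ΣFin (suc m) d + 4 + 4 ≡⟨ cong (_+ 4) sum≡ ⟩
    4 * m + 4          ≡⟨ +-comm (4 * m) 4 ⟩
    4 + 4 * m          ≡⟨ *-suc 4 m ⟨
    4 * suc m          ∎
    where open ≡-Reasoning
  lower : ∀ i → 2 ≤ d i
  lower i = ≤-trans 2≤dₙ (non-increasing i (fromℕ m) (subst (toℕ i ≤_) (sym (toℕ-fromℕ m)) (toℕ≤pred[n] i)))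
  upper : ∀ i → d i + 2 ≤ suc m
  upper i = subst (_≤ suc m) (+-comm 2 (d i)) (s≤s (≤-trans (s≤s (non-increasing fzero i z≤n)) d₁<m))

theorem4p1 : (m : ℕ) (d : Fin (suc m) → ℕ) → Graphical d →
    (Σ (Graph (suc m)) (λ G → IsRealization G d × C4Pivotable G))
      ⇔ ((ΣFin (suc m) d + 4 ≡ 4 * m) × d fzero < m × 2 ≤ d (fromℕ m))
theorem4p1 m d (non-increasing , _) = mk⇔
  (λ (G , realizes , pivotable) → pivotable-realization⇒conditions m d G realizes pivotable)
  (λ conditions → let degree-conditions = conditions⇒degree-conditions m d non-increasing conditions in
     pivotal⇒pivotable-realization (proj₁ degree-conditions) (conditions⇒pivotal m d degree-conditions))
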